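{- Let $p$ be a prime, $d\ge 0$, $\overline x$ a tuple of variables, and let $\Omega$ be a finite nonempty set of $\mathbb F_p$-linear maps from $\mathbb F_p[\overline x]_{\le d}$ to $\mathbb F_p$. Let $\overline g=g_1,\dots,g_m$ be polynomials in $\overline x$, let $h\ge1$, and let $E_{i,\overline g}=g_i\prod_{u\le h}\bigl(1-\sum_{j\le m}r_{uj}g_j\bigr)$, $i\le m$, be the companion extension polynomials of accuracy $h$ with extension variables $r_{uj}$ ($u\le h$, $j\le m$). Assume all $E_{i,\overline g}$ have degree at most $d$. Then for every $\omega\in\Omega$ and every $i\le m$, the probability, over a uniformly random choice of $\overline b=(b_{uj})_{u\le h,j\le m}\in\mathbb F_p^{h\times m}$, that $\omega(g'(\overline x,\overline b))\ne0$ holds for all factor polynomials $g'(\overline x,\overline r)$ of $E_{i,\overline g}$ is at most $e^{ -h/p}$.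
   Context: $\mathbb F_p[\overline x]_{\le d}$ denotes the $\mathbb F_p$-vector space of polynomials in $\overline x$ of degree at most $d$. The factor polynomials of $E_{i,\overline g}$ are the $h+1$ polynomials $g_i$ and $1-\sum_{j\le m}r_{uj}g_j$ for $u\le h$; $g'(\overline x,\overline b)$ denotes the result of substituting $r_{uj}:=b_{uj}$. -}

module Defs where

open import Data.Nat as ℕ using (ℕ; zero; suc; NonZero; _∸_; _^_)
open import Data.Nat.Properties using (m^n≢0)
open import Data.Nat.DivMod using (_mod_)
open import Data.Nat.Base using (_!)
open import Data.Nat.Properties using (_!≢0)
open import Data.Fin as Fin using (Fin; toℕ; combine)
open import Data.Fin.Properties using (_≟_)
open import Data.List using (List; []; _∷_; map; foldr; concatMap; filter; length; allFin)
open import Data.List.Relation.Unary.All as All using (All; all?)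
open import Data.Unit using (⊤)
open import Data.Product using (_×_)
open import Relation.Nullary using (¬_; ¬?)
open import Relation.Binary.PropositionalEquality using (_≡_)
open import Data.Integer using (+_)
import Data.Rational.Unnormalised as Q
open Q using (ℚᵘ)

module _ (p : ℕ) .{{_ : NonZero p}} where

  Fp : Set
  Fp = Fin p

  0F 1F : Fp
  0F = 0 mod p
  1F = 1 mod p

  _+F_ _*F_ : Fp → Fp → Fp
  a +F b = (toℕ a ℕ.+ toℕ b) mod p
  a *F b = (toℕ a ℕ.* toℕ b) mod p

  -F_ : Fp → Fp
  -F a = (p ∸ toℕ a) mod p

  -- Polynomials over F_p in n variables (dense, recursive representation):
  -- Poly 0 = F_p, Poly (suc n) = Poly n [y] (coefficient lists, lowest
  -- degree first); the outermost variable (index zero) is y.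

  Poly : ℕ → Set
  Poly zero    = Fp
  Poly (suc n) = List (Poly n)

  zeroP : ∀ n → Poly n
  zeroP zero    = 0F
  zeroP (suc n) = []

  constP : ∀ n → Fp → Poly n
  constP zero    c = c
  constP (suc n) c = constP n c ∷ []

  oneP : ∀ n → Poly n
  oneP n = constP n 1F

  addP : ∀ n → Poly n → Poly n → Poly n
  addP zero    a b = a +F b
  addP (suc n) []       ys       = ys
  addP (suc n) (x ∷ xs) []       = x ∷ xs
  addP (suc n) (x ∷ xs) (y ∷ ys) = addP n x y ∷ addP (suc n) xs ys

  scaleP : ∀ n → Fp → Poly n → Poly n
  scaleP zero    c a = c *F a
  scaleP (suc n) c xs = map (scaleP n c) xs

  negP : ∀ n → Poly n → Poly n
  negP n f = scaleP n (-F 1F) f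

  mulP : ∀ n → Poly n → Poly n → Poly n
  mulP zero    a b = a *F b
  mulP (suc n) []       ys = []
  mulP (suc n) (x ∷ xs) ys =
    addP (suc n) (map (mulP n x) ys) (zeroP n ∷ mulP (suc n) xs ys)

  sumP : ∀ n → List (Poly n) → Poly n
  sumP n = foldr (addP n) (zeroP n)

  prodP : ∀ n → List (Poly n) → Poly n
  prodP n = foldr (mulP n) (oneP n)

  var : ∀ n → Fin n → Poly n
  var (suc n) Fin.zero    = zeroP n ∷ oneP n ∷ []
  var (suc n) (Fin.suc k) = var n k ∷ []

  IsZeroP : ∀ n → Poly n → Set
  IsZeroP zero    a  = a ≡ 0F
  IsZeroP (suc n) xs = All (IsZeroP n) xs

  EqP : ∀ n → Poly n → Poly n → Set
  EqP zero    a b = a ≡ b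
  EqP (suc n) []       ys       = IsZeroP (suc n) ys
  EqP (suc n) (x ∷ xs) []       = IsZeroP (suc n) (x ∷ xs)
  EqP (suc n) (x ∷ xs) (y ∷ ys) = EqP n x y × EqP (suc n) xs ys

  DegLe : ∀ n → ℕ → Poly n → Set
  DegLe zero    d a = ⊤
  DegLe (suc n) d       []       = ⊤
  DegLe (suc n) zero    (c ∷ cs) = DegLe n zero c × IsZeroP (suc n) cs
  DegLe (suc n) (suc d) (c ∷ cs) = DegLe n (suc d) c × DegLe (suc n) d cs

  -- embedding Poly n into Poly (k + n) (new variables are the outer ones)
  embP : ∀ k {n} → Poly n → Poly (k ℕ.+ n)
  embP zero    f = f
  embP (suc k) f = embP k f ∷ []

  -- substituting values β for the k outer variables
  substP : ∀ k {n} → (Fin k → Fp) → Poly (k ℕ.+ n) → Poly n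
  substP zero    β f = f
  substP (suc k) {n} β cs = horner cs
    where
    horner : List (Poly (k ℕ.+ n)) → Poly n
    horner []       = zeroP n
    horner (c ∷ cs) = addP n (substP k (λ i → β (Fin.suc i)) c)
                             (scaleP n (β Fin.zero) (horner cs))

  -- F_p-linear maps F_p[x]_{≤d} → F_p (given as functions on all of
  -- Poly n whose restriction to degree ≤ d polynomials is linear and
  -- well defined w.r.t. polynomial equality).

  record IsLinearOn (n d : ℕ) (ω : Poly n → Fp) : Set where
    field
      resp  : ∀ f g → DegLe n d f → DegLe n d g → EqP n f g → ω f ≡ ω g
      add   : ∀ f g → DegLe n d f → DegLe n d g →
              ω (addP n f g) ≡ (ω f +F ω g)
      homog : ∀ c f → DegLe n d f → ω (scaleP n c f) ≡ (c *F ω f)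

  -- Companion extension polynomials of accuracy h.  The ambient ring is
  -- F_p[r, x] = Poly (h * m + n); r_{uj} is the variable combine u j.

  module Companion (n m h : ℕ) (g : Fin m → Poly n) where

    N : ℕ
    N = h ℕ.* m ℕ.+ n

    r : Fin h → Fin m → Poly N
    r u j = var N (combine u j Fin.↑ˡ n)

    gE : Fin m → Poly N
    gE j = embP (h ℕ.* m) (g j)

    linFactor : Fin h → Poly N
    linFactor u = addP N (oneP N)
      (negP N (sumP N (map (λ j → mulP N (r u j) (gE j)) (allFin m))))

    factors : Fin m → List (Poly N)
    factors i = gE i ∷ map linFactor (allFin h)

    E : Fin m → Poly N
    E i = mulP N (gE i) (prodP N (map linFactor (allFin h)))

  consF : ∀ {k} → Fp → (Fin k → Fp) → Fin (suc k) → Fp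
  consF a β Fin.zero    = a
  consF a β (Fin.suc i) = β i

  allFns : ∀ k → List (Fin k → Fp)
  allFns zero    = (λ ()) ∷ []
  allFns (suc k) = concatMap (λ a → map (consF a) (allFns k)) (allFin p)

  probAllNonzero : (n m h : ℕ) (g : Fin m → Poly n) (ω : Poly n → Fp)
                   (i : Fin m) → ℚᵘ
  probAllNonzero n m h g ω i =
    Q._/_ (+ length (filter good? (allFns (h ℕ.* m)))) (p ^ (h ℕ.* m))
          {{m^n≢0 p (h ℕ.* m)}}
    where
    open Companion n m h g
    good? = λ (β : Fin (h ℕ.* m) → Fp) →
      all? (λ f → ¬? (ω (substP (h ℕ.* m) β f) ≟ 0F)) (factors i)

-- q ≤ e^{-h/p}, expressed exactly via the partial sums of the exponential
-- series: for q ≥ 0, q ≤ e^{-y} ⇔ q·e^{y} ≤ 1 ⇔ ∀ N, q · Σ_{t≤N} y^t/t! ≤ 1.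

expTerm : (h p : ℕ) .{{_ : NonZero p}} → ℕ → ℚᵘ
expTerm h p t = (Q._/_ (+ (h ^ t)) (p ^ t) {{m^n≢0 p t}})
          Q.* (Q._/_ (+ 1) (t !) {{t !≢0}})

expPartial : (h p : ℕ) .{{_ : NonZero p}} → ℕ → ℚᵘ
expPartial h p zero    = expTerm h p zero
expPartial h p (suc N) = expPartial h p N Q.+ expTerm h p (suc N)

LeExpNeg : ℚᵘ → (h p : ℕ) .{{_ : NonZero p}} → Set
LeExpNeg q h p = ∀ N → q Q.* expPartial h p N Q.≤ Q.1ℚᵘ

-- If ω(g_i) = 0 then no substitution is good, g_i itself being a factor of E_i. Otherwise g_i ≠ 0,
-- and since total degree is additive over the domain F_p[r̄, x̄], deg E_i ≤ d forces deg g_j < d for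
-- all j. So ω is defined on each substituted factor 1 - Σ_j b_uj g_j, where by linearity it is the
-- affine form ω(1) - Σ_j b_uj ω(g_j) of the row b_u, whose b_ui-coefficient is nonzero. Whatever the
-- other entries of b_u, at most p - 1 of the p values of b_ui keep this form nonzero, and the h rows
-- are independent, so at most a fraction (1 - 1/p)^h of the substitutions is good.
-- Finally (1 - 1/p)^h ≤ e^(-h/p) is checked against each partial sum of e^(h/p) = Σ_t h^t / (t! p^t):
-- it lies termwise below the partial sum A_h of (1 - 1/p)^(-h) = Σ_t h(h+1)⋯(h+t-1) / (t! p^t),
-- and (1 - 1/p) A_(h+1) ≤ A_h with A_0 = 1.
module Submission where

open import Defs

open import Algebra.Bundles using (CommutativeRing)
open import Algebra.Consequences.Propositional using (comm∧idˡ⇒id; comm∧invˡ⇒inv; comm∧distrʳ⇒distrˡ)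
open import Algebra.Structures using (IsCommutativeRing)
open import Data.Fin as Fin using (Fin; zero; suc; toℕ; punchIn; _↑ˡ_; _↑ʳ_; combine)
import Data.Fin.Properties as Fin
open import Data.Fin.Properties
  using (_≟_; toℕ-fromℕ<; toℕ-injective; toℕ<n; punchInᵢ≢i; ↑ˡ-injective; combine-injectiveʳ)
open import Data.Integer as ℤ using (+_)
import Data.Integer.Properties as ℤ
open import Data.List using (List; []; _∷_; tabulate; map; allFin; length; filter; concatMap)
  renaming (_++_ to _++ˡ_)
open import Data.List.Membership.Propositional using (_∈_; lose)
open import Data.List.Membership.Propositional.Properties using (∈-map⁺; ∈-allFin)
open import Data.List.Properties
  using (map-tabulate; map-cong; length-tabulate; length-++; filter-≐; filter-++; filter-all; filter-none; filter-notAll)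
open import Data.List.Relation.Unary.All as All using (All; []; _∷_)
import Data.List.Relation.Unary.All.Properties as All
open import Data.List.Relation.Unary.Any using (here; there)
open import Data.Nat as ℕ using (ℕ; zero; suc; NonZero; _∸_; _^_; _!; _≤_; _<_; z≤n; s≤s)
open import Data.Nat.Coprimality using (prime⇒coprime; coprime-Bézout)
open import Data.Nat.DivMod using (_mod_; _%_; %-distribˡ-+; %-distribˡ-*; m<n⇒m%n≡m; n%n≡0; [m+kn]%n≡m%n; m*n%n≡0)
open import Data.Nat.GCD using (module Bézout)
open import Data.Nat.ListAction using () renaming (sum to sumˡ)
open import Data.Nat.Primality using (Prime; prime⇒nonTrivial)
import Data.Nat.Properties as ℕ
open import Data.Nat.Tactic.RingSolver using (solve-∀)
open import Data.Product using (∃; _×_; _,_; proj₁; proj₂)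
import Data.Rational.Unnormalised as Q
open Q using (mkℚᵘ; ↥_; ↧_; ↧ₙ_; *≤*)
open import Data.Rational.Unnormalised.Properties using (↥[n/d]≡n)
open import Data.Sum using (_⊎_; inj₁; inj₂)
open import Data.Unit using (tt)
open import Data.Vec as Vec using (Vec; []; _∷_; _++_)
import Data.Vec.Properties as Vec
open import Function using (id; _∘_; case_of_)
open import Level using (0ℓ)
open import Relation.Binary.Definitions using (tri<; tri≈; tri>)
open import Relation.Binary.PropositionalEquality
  using (_≡_; _≢_; refl; sym; trans; cong; cong₂; subst; subst₂; isEquivalence; module ≡-Reasoning)
open import Relation.Nullary using (¬_; ¬?; Dec; yes; no; contradiction)
open import Relation.Nullary.Decidable using (map′; decidable-stable; _×-dec_)
open import Relation.Unary using (Decidable; _≐_; _⊆_)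

sum-zeros : ∀ k → Vec.sum (Vec.replicate k 0) ≡ 0
sum-zeros zero    = refl
sum-zeros (suc k) = sum-zeros k

sum-updateAt-suc : ∀ {k} (α : Vec ℕ k) v → Vec.sum (Vec.updateAt α v suc) ≡ suc (Vec.sum α)
sum-updateAt-suc (a ∷ α) zero    = refl
sum-updateAt-suc (a ∷ α) (suc v) = trans (cong (a ℕ.+_) (sum-updateAt-suc α v)) (ℕ.+-suc a (Vec.sum α))

*-^ : ∀ a b n → (a ℕ.* b) ^ n ≡ a ^ n ℕ.* b ^ n
*-^ a b zero    = refl
*-^ a b (suc n) = trans (cong (a ℕ.* b ℕ.*_) (*-^ a b n)) (interchange a b (a ^ n) (b ^ n))
  where
  interchange : ∀ w x y z → w ℕ.* x ℕ.* (y ℕ.* z) ≡ w ℕ.* y ℕ.* (x ℕ.* z)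
  interchange = solve-∀

m∸n≤o⇒m≤n+o : ∀ {m n o} → m ∸ n ≤ o → m ≤ n ℕ.+ o
m∸n≤o⇒m≤n+o {m} {n} le = ℕ.≤-trans (ℕ.m≤n+m∸n m n) (ℕ.+-monoʳ-≤ n le)

+-≡-<-swap : ∀ {m n o q} → m ℕ.+ n ≡ o ℕ.+ q → o < m → n < q
+-≡-<-swap m+n≡o+q o<m = ℕ.≰⇒> λ q≤n → ℕ.<-irrefl (sym m+n≡o+q) (ℕ.+-mono-<-≤ o<m q≤n)

∸-+-split : ∀ {i j a b} → i ≤ a → j ≤ b → (i ℕ.+ j) ℕ.+ ((a ∸ i) ℕ.+ (b ∸ j)) ≡ a ℕ.+ b
∸-+-split {i} {j} {a} {b} i≤a j≤b = begin
  (i ℕ.+ j) ℕ.+ ((a ∸ i) ℕ.+ (b ∸ j))  ≡⟨ shuffle i j (a ∸ i) (b ∸ j) ⟩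
  (i ℕ.+ (a ∸ i)) ℕ.+ (j ℕ.+ (b ∸ j))  ≡⟨ cong₂ ℕ._+_ (ℕ.m+[n∸m]≡n i≤a) (ℕ.m+[n∸m]≡n j≤b) ⟩
  a ℕ.+ b                              ∎
  where
  open ≡-Reasoning
  shuffle : ∀ w x y z → (w ℕ.+ x) ℕ.+ (y ℕ.+ z) ≡ (w ℕ.+ y) ℕ.+ (x ℕ.+ z)
  shuffle = solve-∀

∸-+-≤ : ∀ {i j a b x} → i ≤ a → j ≤ b → a ℕ.+ b ≤ suc ((i ℕ.+ j) ℕ.+ x) → (a ∸ i) ℕ.+ (b ∸ j) ≤ suc x
∸-+-≤ {i} {j} {a} {b} {x} i≤a j≤b a+b≤ = ℕ.+-cancelˡ-≤ (i ℕ.+ j) _ _ (begin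
  (i ℕ.+ j) ℕ.+ ((a ∸ i) ℕ.+ (b ∸ j))  ≡⟨ ∸-+-split i≤a j≤b ⟩
  a ℕ.+ b                              ≤⟨ a+b≤ ⟩
  suc ((i ℕ.+ j) ℕ.+ x)                ≡⟨ ℕ.+-suc (i ℕ.+ j) x ⟨
  (i ℕ.+ j) ℕ.+ suc x                  ∎)
  where open ℕ.≤-Reasoning

∸-balance : ∀ {i j i₀ j₀ a b} → i ≤ a → j ≤ b → i₀ ≤ a → j₀ ≤ b → i ℕ.+ j ≡ i₀ ℕ.+ j₀ →
            (a ∸ i) ℕ.+ (b ∸ j) ≡ (a ∸ i₀) ℕ.+ (b ∸ j₀)
∸-balance {i} {j} {i₀} {j₀} {a} {b} i≤a j≤b i₀≤a j₀≤b i+j≡i₀+j₀ = ℕ.+-cancelˡ-≡ (i ℕ.+ j) _ _ (begin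
  (i ℕ.+ j) ℕ.+ ((a ∸ i) ℕ.+ (b ∸ j))      ≡⟨ ∸-+-split i≤a j≤b ⟩
  a ℕ.+ b                                  ≡⟨ ∸-+-split i₀≤a j₀≤b ⟨
  (i₀ ℕ.+ j₀) ℕ.+ ((a ∸ i₀) ℕ.+ (b ∸ j₀))  ≡⟨ cong (ℕ._+ ((a ∸ i₀) ℕ.+ (b ∸ j₀))) i+j≡i₀+j₀ ⟨
  (i ℕ.+ j) ℕ.+ ((a ∸ i₀) ℕ.+ (b ∸ j₀))    ∎)
  where open ≡-Reasoning

greatest-≤ : ∀ {P : ℕ → Set} → Decidable P → ∀ {i} n → i ≤ n → P i →
             ∃ λ m → m ≤ n × P m × (∀ {k} → m < k → k ≤ n → ¬ P k)
greatest-≤ P? {i} n i≤n Pi with P? n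
... | yes Pn = n , ℕ.≤-refl , Pn , λ n<k k≤n → contradiction k≤n (ℕ.<⇒≱ n<k)
greatest-≤ P? {i} zero    z≤n Pi | no ¬Pn = contradiction Pi ¬Pn
greatest-≤ P? {i} (suc n) i≤n Pi | no ¬Pn with ℕ.m≤n⇒m<n∨m≡n i≤n
... | inj₂ refl = contradiction Pi ¬Pn
... | inj₁ i<n with m , m≤n , Pm , above ← greatest-≤ P? n (ℕ.≤-pred i<n) Pi =
  m , ℕ.m≤n⇒m≤1+n m≤n , Pm , λ {k} m<k k≤1+n → case ℕ.m≤n⇒m<n∨m≡n k≤1+n of λ where
    (inj₁ k<1+n) → above m<k (ℕ.≤-pred k<1+n)
    (inj₂ refl)  → ¬Pn

module _ {A : Set} where

  sum-map-const : ∀ K (xs : List A) → sumˡ (map (λ _ → K) xs) ≡ length xs ℕ.* K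
  sum-map-const K []       = refl
  sum-map-const K (x ∷ xs) = cong (K ℕ.+_) (sum-map-const K xs)

  sum-map-*ʳ : ∀ (f : A → ℕ) K xs → sumˡ (map (λ x → f x ℕ.* K) xs) ≡ sumˡ (map f xs) ℕ.* K
  sum-map-*ʳ f K []       = refl
  sum-map-*ʳ f K (x ∷ xs) =
    trans (cong (f x ℕ.* K ℕ.+_) (sum-map-*ʳ f K xs)) (sym (ℕ.*-distribʳ-+ K (f x) _))

  sum-map-mono : ∀ {f g : A → ℕ} → (∀ x → f x ≤ g x) → ∀ xs → sumˡ (map f xs) ≤ sumˡ (map g xs)
  sum-map-mono f≤g []       = z≤n
  sum-map-mono f≤g (x ∷ xs) = ℕ.+-mono-≤ (f≤g x) (sum-map-mono f≤g xs)

count : ∀ {A : Set} {P : A → Set} → Decidable P → List A → ℕ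
count P? xs = length (filter P? xs)

indicator : ∀ {Q : Set} → Dec Q → ℕ
indicator (yes _) = 1
indicator (no _)  = 0

module _ {A : Set} {P Q : A → Set} (P? : Decidable P) (Q? : Decidable Q) where

  count-≐ : P ≐ Q → ∀ xs → count P? xs ≡ count Q? xs
  count-≐ P≐Q xs = cong length (filter-≐ P? Q? P≐Q xs)

  count-mono : P ⊆ Q → ∀ xs → count P? xs ≤ count Q? xs
  count-mono P⊆Q []       = z≤n
  count-mono P⊆Q (x ∷ xs) with P? x | Q? x
  ... | yes _  | yes _  = s≤s (count-mono P⊆Q xs)
  ... | yes Px | no ¬Qx = contradiction (P⊆Q Px) ¬Qx
  ... | no _   | yes _  = ℕ.m≤n⇒m≤1+n (count-mono P⊆Q xs)
  ... | no _   | no _   = count-mono P⊆Q xs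

module _ {A : Set} {P : A → Set} (P? : Decidable P) where

  count-∷ : ∀ x xs → count P? (x ∷ xs) ≡ indicator (P? x) ℕ.+ count P? xs
  count-∷ x xs with P? x
  ... | yes _ = refl
  ... | no _  = refl

  count-++ : ∀ xs ys → count P? (xs ++ˡ ys) ≡ count P? xs ℕ.+ count P? ys
  count-++ xs ys = trans (cong length (filter-++ P? xs ys)) (length-++ (filter P? xs))

  count-concatMap : ∀ {B : Set} (f : B → List A) ys →
                    count P? (concatMap f ys) ≡ sumˡ (map (count P? ∘ f) ys)
  count-concatMap f []       = refl
  count-concatMap f (y ∷ ys) = trans (count-++ (f y) (concatMap f ys)) (cong (count P? (f y) ℕ.+_) (count-concatMap f ys))

  count-map : ∀ {B : Set} (f : B → A) ys → count P? (map f ys) ≡ count (P? ∘ f) ys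
  count-map f []       = refl
  count-map f (y ∷ ys) with P? (f y)
  ... | yes _ = cong suc (count-map f ys)
  ... | no _  = count-map f ys

count-const : ∀ {A Q : Set} (Q? : Dec Q) (xs : List A) → count (λ _ → Q?) xs ≡ indicator Q? ℕ.* length xs
count-const (yes q) xs = trans (cong length (filter-all (λ _ → yes q) (All.universal (λ _ → q) xs))) (sym (ℕ.+-identityʳ _))
count-const (no ¬q) xs = cong length (filter-none (λ _ → no ¬q) (All.universal (λ _ → ¬q) xs))

sum-map-indicator : ∀ {A : Set} {Q : A → Set} (Q? : Decidable Q) K xs → sumˡ (map (λ x → indicator (Q? x) ℕ.* K) xs) ≡ count Q? xs ℕ.* K
sum-map-indicator Q? K []       = refl
sum-map-indicator Q? K (x ∷ xs) = trans (cong (indicator (Q? x) ℕ.* K ℕ.+_) (sum-map-indicator Q? K xs))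
  (trans (sym (ℕ.*-distribʳ-+ K (indicator (Q? x)) _)) (cong (ℕ._* K) (sym (count-∷ Q? x xs))))

count-×-const : ∀ {A D : Set} {Q : A → Set} (D? : Dec D) (Q? : Decidable Q) xs →
                count (λ x → D? ×-dec Q? x) xs ≡ indicator D? ℕ.* count Q? xs
count-×-const (yes d) Q? xs =
  trans (count-≐ _ Q? (proj₂ , (d ,_)) xs) (sym (ℕ.+-identityʳ _))
count-×-const (no ¬d) Q? xs = cong length (filter-none _ (All.universal (λ _ → ¬d ∘ proj₁) xs))

module PrimeField (p : ℕ) .{{_ : NonZero p}} where

  𝔽 : Set
  𝔽 = Fp p

  infixl 6 _⊕_
  infixl 7 _⊗_
  infix  8 ⊖_

  _⊕_ _⊗_ : 𝔽 → 𝔽 → 𝔽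
  _⊕_ = _+F_ p
  _⊗_ = _*F_ p

  ⊖_ : 𝔽 → 𝔽
  ⊖_ = -F_ p

  𝟘 𝟙 : 𝔽
  𝟘 = 0F p
  𝟙 = 1F p

  -- Fp p inherits the ring laws of ℕ through the reduction map [_].
  [_] : ℕ → 𝔽
  [ m ] = m mod p

  toℕ-[] : ∀ m → toℕ [ m ] ≡ m % p
  toℕ-[] m = toℕ-fromℕ< _

  []-toℕ : ∀ a → [ toℕ a ] ≡ a
  []-toℕ a = toℕ-injective (trans (toℕ-[] (toℕ a)) (m<n⇒m%n≡m (toℕ<n a)))

  []-cong : ∀ {m n} → m % p ≡ n % p → [ m ] ≡ [ n ]
  []-cong {m} {n} eq = toℕ-injective (trans (toℕ-[] m) (trans eq (sym (toℕ-[] n))))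

  []-+ : ∀ m n → [ m ℕ.+ n ] ≡ [ m ] ⊕ [ n ]
  []-+ m n = []-cong (trans (%-distribˡ-+ m n p)
                            (sym (cong₂ (λ x y → (x ℕ.+ y) % p) (toℕ-[] m) (toℕ-[] n))))

  []-* : ∀ m n → [ m ℕ.* n ] ≡ [ m ] ⊗ [ n ]
  []-* m n = []-cong (trans (%-distribˡ-* m n p)
                            (sym (cong₂ (λ x y → (x ℕ.* y) % p) (toℕ-[] m) (toℕ-[] n))))

  0%p≡0 : 0 % p ≡ 0
  0%p≡0 = m<n⇒m%n≡m (ℕ.n≢0⇒n>0 (ℕ.≢-nonZero⁻¹ p))

  [0]≡𝟘 : ∀ {m} → m % p ≡ 0 → [ m ] ≡ 𝟘
  [0]≡𝟘 m%p≡0 = []-cong (trans m%p≡0 (sym 0%p≡0))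

  ⊕-comm : ∀ a b → a ⊕ b ≡ b ⊕ a
  ⊕-comm a b = cong [_] (ℕ.+-comm (toℕ a) (toℕ b))

  ⊗-comm : ∀ a b → a ⊗ b ≡ b ⊗ a
  ⊗-comm a b = cong [_] (ℕ.*-comm (toℕ a) (toℕ b))

  ⊕-assoc : ∀ a b c → (a ⊕ b) ⊕ c ≡ a ⊕ (b ⊕ c)
  ⊕-assoc a b c = begin
    [ toℕ a ℕ.+ toℕ b ] ⊕ c            ≡⟨ cong ((a ⊕ b) ⊕_) ([]-toℕ c) ⟨
    [ toℕ a ℕ.+ toℕ b ] ⊕ [ toℕ c ]    ≡⟨ []-+ _ (toℕ c) ⟨
    [ toℕ a ℕ.+ toℕ b ℕ.+ toℕ c ]      ≡⟨ cong [_] (ℕ.+-assoc (toℕ a) _ _) ⟩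
    [ toℕ a ℕ.+ (toℕ b ℕ.+ toℕ c) ]    ≡⟨ []-+ (toℕ a) _ ⟩
    [ toℕ a ] ⊕ (b ⊕ c)                ≡⟨ cong (_⊕ (b ⊕ c)) ([]-toℕ a) ⟩
    a ⊕ (b ⊕ c)                        ∎
    where open ≡-Reasoning

  ⊗-assoc : ∀ a b c → (a ⊗ b) ⊗ c ≡ a ⊗ (b ⊗ c)
  ⊗-assoc a b c = begin
    [ toℕ a ℕ.* toℕ b ] ⊗ c            ≡⟨ cong ((a ⊗ b) ⊗_) ([]-toℕ c) ⟨
    [ toℕ a ℕ.* toℕ b ] ⊗ [ toℕ c ]    ≡⟨ []-* _ (toℕ c) ⟨
    [ toℕ a ℕ.* toℕ b ℕ.* toℕ c ]      ≡⟨ cong [_] (ℕ.*-assoc (toℕ a) _ _) ⟩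
    [ toℕ a ℕ.* (toℕ b ℕ.* toℕ c) ]    ≡⟨ []-* (toℕ a) _ ⟩
    [ toℕ a ] ⊗ (b ⊗ c)                ≡⟨ cong (_⊗ (b ⊗ c)) ([]-toℕ a) ⟩
    a ⊗ (b ⊗ c)                        ∎
    where open ≡-Reasoning

  ⊗-distribʳ-⊕ : ∀ a b c → (b ⊕ c) ⊗ a ≡ b ⊗ a ⊕ c ⊗ a
  ⊗-distribʳ-⊕ a b c = begin
    [ toℕ b ℕ.+ toℕ c ] ⊗ a                  ≡⟨ cong ((b ⊕ c) ⊗_) ([]-toℕ a) ⟨
    [ toℕ b ℕ.+ toℕ c ] ⊗ [ toℕ a ]          ≡⟨ []-* _ (toℕ a) ⟨
    [ (toℕ b ℕ.+ toℕ c) ℕ.* toℕ a ]          ≡⟨ cong [_] (ℕ.*-distribʳ-+ (toℕ a) (toℕ b) _) ⟩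
    [ toℕ b ℕ.* toℕ a ℕ.+ toℕ c ℕ.* toℕ a ]  ≡⟨ []-+ _ _ ⟩
    b ⊗ a ⊕ c ⊗ a                            ∎
    where open ≡-Reasoning

  ⊕-identityˡ : ∀ a → 𝟘 ⊕ a ≡ a
  ⊕-identityˡ a = trans (cong (𝟘 ⊕_) (sym ([]-toℕ a))) (trans (sym ([]-+ 0 (toℕ a))) ([]-toℕ a))

  ⊗-identityˡ : ∀ a → 𝟙 ⊗ a ≡ a
  ⊗-identityˡ a = trans (cong (𝟙 ⊗_) (sym ([]-toℕ a)))
                        (trans (sym ([]-* 1 (toℕ a))) (trans (cong [_] (ℕ.*-identityˡ (toℕ a))) ([]-toℕ a)))

  ⊖-inverseˡ : ∀ a → ⊖ a ⊕ a ≡ 𝟘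
  ⊖-inverseˡ a = begin
    [ p ∸ toℕ a ] ⊕ a              ≡⟨ cong (⊖ a ⊕_) ([]-toℕ a) ⟨
    [ p ∸ toℕ a ] ⊕ [ toℕ a ]      ≡⟨ []-+ (p ∸ toℕ a) (toℕ a) ⟨
    [ p ∸ toℕ a ℕ.+ toℕ a ]        ≡⟨ cong [_] (ℕ.m∸n+n≡m (ℕ.<⇒≤ (toℕ<n a))) ⟩
    [ p ]                          ≡⟨ [0]≡𝟘 (n%n≡0 p) ⟩
    𝟘                              ∎
    where open ≡-Reasoning

  Fp-isCommutativeRing : IsCommutativeRing _≡_ _⊕_ _⊗_ ⊖_ 𝟘 𝟙
  Fp-isCommutativeRing = record
    { isRing = record
      { +-isAbelianGroup = record
        { isGroup = record
          { isMonoid = record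
            { isSemigroup = record { isMagma = record { isEquivalence = isEquivalence ; ∙-cong = cong₂ _⊕_ }
                                   ; assoc = ⊕-assoc }
            ; identity = comm∧idˡ⇒id ⊕-comm ⊕-identityˡ }
          ; inverse = comm∧invˡ⇒inv ⊕-comm ⊖-inverseˡ
          ; ⁻¹-cong = cong ⊖_ }
        ; comm = ⊕-comm }
      ; *-cong = cong₂ _⊗_
      ; *-assoc = ⊗-assoc
      ; *-identity = comm∧idˡ⇒id ⊗-comm ⊗-identityˡ
      ; distrib = comm∧distrʳ⇒distrˡ ⊗-comm ⊗-distribʳ-⊕ , ⊗-distribʳ-⊕ }
    ; *-comm = ⊗-comm }

  Fp-commutativeRing : CommutativeRing 0ℓ 0ℓ
  Fp-commutativeRing = record { isCommutativeRing = Fp-isCommutativeRing }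

  open CommutativeRing Fp-commutativeRing public
    using (+-identityʳ; -‿inverseʳ; *-identityʳ; zeroˡ; zeroʳ; distribˡ; ring; semiring;
           +-commutativeSemigroup; *-commutativeSemigroup)
  open import Algebra.Properties.CommutativeSemigroup +-commutativeSemigroup public
    using () renaming (interchange to ⊕-interchange)
  open import Algebra.Properties.CommutativeSemigroup *-commutativeSemigroup public
    using () renaming (x∙yz≈y∙xz to ⊗-left-comm)
  open import Algebra.Properties.Ring ring public
    using (-‿distribʳ-*; -‿involutive; +-inverseʳ-unique; -0#≈0#)
  open import Algebra.Properties.Semiring.Sum semiring public
    using (sum-syntax; sum-cong-≗; sum-replicate-zero; sum-remove; *-distribˡ-sum)

  ∑-zero : ∀ {m} (f : Fin m → 𝔽) → (∀ j → f j ≡ 𝟘) → ∑[ j < m ] f j ≡ 𝟘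
  ∑-zero {m} f f≡𝟘 = trans (sum-cong-≗ f≡𝟘) (sum-replicate-zero m)

  ∑-head : ∀ {m} (f : Fin (suc m) → 𝔽) → (∀ j → f (suc j) ≡ 𝟘) → ∑[ j < suc m ] f j ≡ f zero
  ∑-head f rest≡𝟘 = trans (cong (f zero ⊕_) (∑-zero _ rest≡𝟘)) (+-identityʳ (f zero))

  ∑-single : ∀ {m} (f : Fin m → 𝔽) i → (∀ j → j ≢ i → f j ≡ 𝟘) → ∑[ j < m ] f j ≡ f i
  ∑-single {suc m} f i others = begin
    ∑[ j < suc m ] f j                  ≡⟨ sum-remove {i = i} f ⟩
    f i ⊕ ∑[ j < m ] f (punchIn i j)    ≡⟨ cong (f i ⊕_) (∑-zero _ (λ j → others _ (punchInᵢ≢i i j))) ⟩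
    f i ⊕ 𝟘                             ≡⟨ +-identityʳ (f i) ⟩
    f i                                 ∎
    where open ≡-Reasoning

  module _ (p-prime : Prime p) where

    1<p : 1 ℕ.< p
    1<p = ℕ.nonTrivial⇒n>1 p {{prime⇒nonTrivial p-prime}}

    𝟙≢𝟘 : 𝟙 ≢ 𝟘
    𝟙≢𝟘 𝟙≡𝟘 = ℕ.1+n≢0 (begin
      1         ≡⟨ m<n⇒m%n≡m 1<p ⟨
      1 % p     ≡⟨ toℕ-[] 1 ⟨
      toℕ 𝟙     ≡⟨ cong toℕ 𝟙≡𝟘 ⟩
      toℕ 𝟘     ≡⟨ toℕ-[] 0 ⟩
      0 % p     ≡⟨ 0%p≡0 ⟩
      0         ∎)
      where open ≡-Reasoning

    ⊗-inverse : ∀ {a} → a ≢ 𝟘 → ∃ λ b → a ⊗ b ≡ 𝟙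
    ⊗-inverse {a} a≢𝟘 with coprime-Bézout (prime⇒coprime p-prime {{A≢0}} (toℕ<n a))
      where
      A≢0 : NonZero (toℕ a)
      A≢0 = ℕ.≢-nonZero (λ A≡0 → a≢𝟘 (trans (sym ([]-toℕ a)) (cong [_] A≡0)))
    ... | Bézout.+- x y 1+yA≡xp = ⊖ [ y ] , (begin
      a ⊗ ⊖ [ y ]      ≡⟨ -‿distribʳ-* a [ y ] ⟨
      ⊖ (a ⊗ [ y ])    ≡⟨ cong ⊖_ (trans (⊗-comm a [ y ]) (+-inverseʳ-unique 𝟙 _ 𝟙+ya≡𝟘)) ⟩
      ⊖ ⊖ 𝟙            ≡⟨ -‿involutive 𝟙 ⟩
      𝟙                ∎)
      where
      open ≡-Reasoning
      𝟙+ya≡𝟘 : 𝟙 ⊕ [ y ] ⊗ a ≡ 𝟘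
      𝟙+ya≡𝟘 = begin
        𝟙 ⊕ [ y ] ⊗ a            ≡⟨ cong (λ z → 𝟙 ⊕ [ y ] ⊗ z) ([]-toℕ a) ⟨
        [ 1 ] ⊕ [ y ] ⊗ [ toℕ a ] ≡⟨ cong ([ 1 ] ⊕_) ([]-* y (toℕ a)) ⟨
        [ 1 ] ⊕ [ y ℕ.* toℕ a ]   ≡⟨ []-+ 1 _ ⟨
        [ 1 ℕ.+ y ℕ.* toℕ a ]     ≡⟨ cong [_] 1+yA≡xp ⟩
        [ x ℕ.* p ]               ≡⟨ [0]≡𝟘 (m*n%n≡0 x p) ⟩
        𝟘                         ∎
    ... | Bézout.-+ x y 1+xp≡yA = [ y ] , (begin
      a ⊗ [ y ]                 ≡⟨ ⊗-comm a [ y ] ⟩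
      [ y ] ⊗ a                 ≡⟨ cong ([ y ] ⊗_) ([]-toℕ a) ⟨
      [ y ] ⊗ [ toℕ a ]         ≡⟨ []-* y (toℕ a) ⟨
      [ y ℕ.* toℕ a ]           ≡⟨ cong [_] 1+xp≡yA ⟨
      [ 1 ℕ.+ x ℕ.* p ]         ≡⟨ []-cong ([m+kn]%n≡m%n 1 x p) ⟩
      𝟙                         ∎)
      where open ≡-Reasoning

    ⊗-nonzero : ∀ {a b} → a ≢ 𝟘 → b ≢ 𝟘 → a ⊗ b ≢ 𝟘
    ⊗-nonzero {a} {b} a≢𝟘 b≢𝟘 ab≡𝟘 with a′ , aa′≡𝟙 ← ⊗-inverse a≢𝟘 = b≢𝟘 (begin
      b                ≡⟨ ⊗-identityˡ b ⟨
      𝟙 ⊗ b            ≡⟨ cong (_⊗ b) (trans (sym aa′≡𝟙) (⊗-comm a a′)) ⟩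
      a′ ⊗ a ⊗ b       ≡⟨ ⊗-assoc a′ a b ⟩
      a′ ⊗ (a ⊗ b)     ≡⟨ cong (a′ ⊗_) ab≡𝟘 ⟩
      a′ ⊗ 𝟘           ≡⟨ zeroʳ a′ ⟩
      𝟘                ∎)
      where open ≡-Reasoning

    ⊖𝟙≢𝟘 : ⊖ 𝟙 ≢ 𝟘
    ⊖𝟙≢𝟘 ⊖𝟙≡𝟘 = 𝟙≢𝟘 (trans (sym (-‿involutive 𝟙)) (trans (cong ⊖_ ⊖𝟙≡𝟘) -0#≈0#))

    affine-root : ∀ c {a} → a ≢ 𝟘 → ∃ λ x → c ⊕ x ⊗ a ≡ 𝟘
    affine-root c {a} a≢𝟘 with a′ , aa′≡𝟙 ← ⊗-inverse a≢𝟘 = ⊖ c ⊗ a′ , (begin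
      c ⊕ ⊖ c ⊗ a′ ⊗ a     ≡⟨ cong (c ⊕_) (⊗-assoc (⊖ c) a′ a) ⟩
      c ⊕ ⊖ c ⊗ (a′ ⊗ a)   ≡⟨ cong (λ z → c ⊕ ⊖ c ⊗ z) (trans (⊗-comm a′ a) aa′≡𝟙) ⟩
      c ⊕ ⊖ c ⊗ 𝟙          ≡⟨ cong (c ⊕_) (*-identityʳ (⊖ c)) ⟩
      c ⊕ ⊖ c              ≡⟨ -‿inverseʳ c ⟩
      𝟘                    ∎)
      where open ≡-Reasoning


module Coefficients (p : ℕ) .{{_ : NonZero p}} where

  open PrimeField p

  -- nth k f s is the coefficient of y^s in f, read as a polynomial over Poly k in the outermost
  -- variable y; coeff k f α is the coefficient of the monomial with exponent vector α, outermost
  -- variable first.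
  nth : ∀ k → List (Poly p k) → ℕ → Poly p k
  nth k []       _       = zeroP p k
  nth k (c ∷ cs) zero    = c
  nth k (c ∷ cs) (suc s) = nth k cs s

  coeff : ∀ k → Poly p k → Vec ℕ k → 𝔽
  coeff zero    c  []      = c
  coeff (suc k) cs (s ∷ α) = coeff k (nth k cs s) α

  Vanishes : ∀ k → Poly p k → Set
  Vanishes k f = ∀ α → coeff k f α ≡ 𝟘

  SameCoeffs : ∀ k → Poly p k → Poly p k → Set
  SameCoeffs k f g = ∀ α → coeff k f α ≡ coeff k g α

  zeroP-vanishes : ∀ k → Vanishes k (zeroP p k)
  zeroP-vanishes zero    []      = refl
  zeroP-vanishes (suc k) (s ∷ α) = zeroP-vanishes k α

  coeff-addP : ∀ k f g α → coeff k (addP p k f g) α ≡ coeff k f α ⊕ coeff k g α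
  coeff-addP zero    f        g        []          = refl
  coeff-addP (suc k) []       ys       (s ∷ α)     =
    sym (trans (cong (_⊕ coeff (suc k) ys (s ∷ α)) (zeroP-vanishes k α)) (⊕-identityˡ _))
  coeff-addP (suc k) (x ∷ xs) []       (s ∷ α)     =
    sym (trans (cong (coeff (suc k) (x ∷ xs) (s ∷ α) ⊕_) (zeroP-vanishes k α)) (+-identityʳ _))
  coeff-addP (suc k) (x ∷ xs) (y ∷ ys) (zero ∷ α)  = coeff-addP k x y α
  coeff-addP (suc k) (x ∷ xs) (y ∷ ys) (suc s ∷ α) = coeff-addP (suc k) xs ys (s ∷ α)

  coeff-scaleP : ∀ k c f α → coeff k (scaleP p k c f) α ≡ c ⊗ coeff k f α
  coeff-scaleP zero    c f        []          = refl
  coeff-scaleP (suc k) c []       (s ∷ α)     =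
    trans (zeroP-vanishes k α) (sym (trans (cong (c ⊗_) (zeroP-vanishes k α)) (zeroʳ c)))
  coeff-scaleP (suc k) c (x ∷ xs) (zero ∷ α)  = coeff-scaleP k c x α
  coeff-scaleP (suc k) c (x ∷ xs) (suc s ∷ α) = coeff-scaleP (suc k) c xs (s ∷ α)

  coeff-sumP : ∀ k {m} (fs : Fin m → Poly p k) α →
               coeff k (sumP p k (tabulate fs)) α ≡ ∑[ j < m ] coeff k (fs j) α
  coeff-sumP k {zero}  fs α = zeroP-vanishes k α
  coeff-sumP k {suc m} fs α =
    trans (coeff-addP k _ _ α) (cong (coeff k (fs zero) α ⊕_) (coeff-sumP k (fs ∘ suc) α))

  coeff-constP-0 : ∀ k c α → Vec.sum α ≡ 0 → coeff k (constP p k c) α ≡ c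
  coeff-constP-0 zero    c []         _  = refl
  coeff-constP-0 (suc k) c (zero ∷ α) eq = coeff-constP-0 k c α eq

  coeff-constP-pos : ∀ k c α → 0 < Vec.sum α → coeff k (constP p k c) α ≡ 𝟘
  coeff-constP-pos (suc k) c (zero ∷ α)  pos = coeff-constP-pos k c α pos
  coeff-constP-pos (suc k) c (suc s ∷ α) _   = zeroP-vanishes k α

  coeff-embP : ∀ j {n} (f : Poly p n) γ α →
               coeff (j ℕ.+ n) (embP p j f) (γ ++ α) ≡ coeff j (constP p j (coeff n f α)) γ
  coeff-embP zero    f []          α = refl
  coeff-embP (suc j) f (zero ∷ γ)  α = coeff-embP j f γ α
  coeff-embP (suc j) f (suc s ∷ γ) α = trans (zeroP-vanishes _ (γ ++ α)) (sym (zeroP-vanishes j γ))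

  vanishes⇒IsZeroP : ∀ k f → Vanishes k f → IsZeroP p k f
  vanishes⇒IsZeroP zero    c        z = z []
  vanishes⇒IsZeroP (suc k) []       z = []
  vanishes⇒IsZeroP (suc k) (c ∷ cs) z =
    vanishes⇒IsZeroP k c (λ α → z (zero ∷ α)) ∷ vanishes⇒IsZeroP (suc k) cs (λ { (s ∷ α) → z (suc s ∷ α) })

  IsZeroP⇒vanishes : ∀ k f → IsZeroP p k f → Vanishes k f
  IsZeroP⇒vanishes zero    c        z          []          = z
  IsZeroP⇒vanishes (suc k) []       _          (s ∷ α)     = zeroP-vanishes k α
  IsZeroP⇒vanishes (suc k) (c ∷ cs) (zc ∷ _)   (zero ∷ α)  = IsZeroP⇒vanishes k c zc α
  IsZeroP⇒vanishes (suc k) (c ∷ cs) (_ ∷ zcs)  (suc s ∷ α) = IsZeroP⇒vanishes (suc k) cs zcs (s ∷ α)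

  sameCoeffs⇒EqP : ∀ k f g → SameCoeffs k f g → EqP p k f g
  sameCoeffs⇒EqP zero    f        g        e = e []
  sameCoeffs⇒EqP (suc k) []       ys       e =
    vanishes⇒IsZeroP (suc k) ys (λ α → trans (sym (e α)) (zeroP-vanishes (suc k) α))
  sameCoeffs⇒EqP (suc k) (x ∷ xs) []       e =
    vanishes⇒IsZeroP (suc k) (x ∷ xs) (λ α → trans (e α) (zeroP-vanishes (suc k) α))
  sameCoeffs⇒EqP (suc k) (x ∷ xs) (y ∷ ys) e =
    sameCoeffs⇒EqP k x y (λ α → e (zero ∷ α)) , sameCoeffs⇒EqP (suc k) xs ys (λ { (s ∷ α) → e (suc s ∷ α) })

  VanishesFrom : ∀ k → ℕ → Poly p k → Set
  VanishesFrom k a f = ∀ α → a ≤ Vec.sum α → coeff k f α ≡ 𝟘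

  DegLe⇒vanishesFrom : ∀ k d f → DegLe p k d f → VanishesFrom k (suc d) f
  DegLe⇒vanishesFrom (suc k) d       []       _           (s ∷ α)     _  = zeroP-vanishes k α
  DegLe⇒vanishesFrom (suc k) zero    (c ∷ cs) (degc , _)  (zero ∷ α)  lt = DegLe⇒vanishesFrom k zero c degc α lt
  DegLe⇒vanishesFrom (suc k) zero    (c ∷ cs) (_ , zcs)   (suc s ∷ α) _  = IsZeroP⇒vanishes (suc k) cs zcs (s ∷ α)
  DegLe⇒vanishesFrom (suc k) (suc d) (c ∷ cs) (degc , _)  (zero ∷ α)  lt = DegLe⇒vanishesFrom k (suc d) c degc α lt
  DegLe⇒vanishesFrom (suc k) (suc d) (c ∷ cs) (_ , degcs) (suc s ∷ α) (s≤s lt) =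
    DegLe⇒vanishesFrom (suc k) d cs degcs (s ∷ α) lt

  vanishesFrom⇒DegLe : ∀ k d f → VanishesFrom k (suc d) f → DegLe p k d f
  vanishesFrom⇒DegLe zero    d       f        _ = tt
  vanishesFrom⇒DegLe (suc k) d       []       _ = tt
  vanishesFrom⇒DegLe (suc k) zero    (c ∷ cs) v =
    vanishesFrom⇒DegLe k zero c (λ α → v (zero ∷ α)) ,
    vanishes⇒IsZeroP (suc k) cs (λ { (s ∷ α) → v (suc s ∷ α) (s≤s z≤n) })
  vanishesFrom⇒DegLe (suc k) (suc d) (c ∷ cs) v =
    vanishesFrom⇒DegLe k (suc d) c (λ α → v (zero ∷ α)) ,
    vanishesFrom⇒DegLe (suc k) d cs (λ { (s ∷ α) lt → v (suc s ∷ α) (s≤s lt) })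

  mulP-zeroˡ-vanishes : ∀ k g → Vanishes k (mulP p k (zeroP p k) g)
  mulP-zeroˡ-vanishes zero    g []  = zeroˡ g
  mulP-zeroˡ-vanishes (suc k) g α   = zeroP-vanishes (suc k) α

  mulP-zeroʳ-vanishes : ∀ k f → Vanishes k (mulP p k f (zeroP p k))
  mulP-zeroʳ-vanishes zero    f        []          = zeroʳ f
  mulP-zeroʳ-vanishes (suc k) []       α           = zeroP-vanishes (suc k) α
  mulP-zeroʳ-vanishes (suc k) (x ∷ xs) (zero ∷ α)  = zeroP-vanishes k α
  mulP-zeroʳ-vanishes (suc k) (x ∷ xs) (suc s ∷ α) = mulP-zeroʳ-vanishes (suc k) xs (s ∷ α)

  coeff-nth-map-mulP : ∀ k x ys s α →
                       coeff k (nth k (map (mulP p k x) ys) s) α ≡ coeff k (mulP p k x (nth k ys s)) α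
  coeff-nth-map-mulP k x []       s       α = trans (zeroP-vanishes k α) (sym (mulP-zeroʳ-vanishes k x α))
  coeff-nth-map-mulP k x (y ∷ ys) zero    α = refl
  coeff-nth-map-mulP k x (y ∷ ys) (suc s) α = coeff-nth-map-mulP k x ys s α

  coeff-mulP : ∀ k xs ys s α →
               coeff (suc k) (mulP p (suc k) xs ys) (s ∷ α) ≡
               ∑[ i < suc s ] coeff k (mulP p k (nth k xs (toℕ i)) (nth k ys (s ∸ toℕ i))) α
  coeff-mulP k []       ys s       α =
    trans (zeroP-vanishes k α)
          (sym (∑-zero {suc s} (λ i → coeff k (mulP p k (zeroP p k) (nth k ys (s ∸ toℕ i))) α)
                       (λ i → mulP-zeroˡ-vanishes k _ α)))
  coeff-mulP k (x ∷ xs) ys zero    α =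
    trans (coeff-addP (suc k) (map (mulP p k x) ys) (zeroP p k ∷ mulP p (suc k) xs ys) (zero ∷ α))
          (cong₂ _⊕_ (coeff-nth-map-mulP k x ys zero α) (zeroP-vanishes k α))
  coeff-mulP k (x ∷ xs) ys (suc s) α =
    trans (coeff-addP (suc k) (map (mulP p k x) ys) (zeroP p k ∷ mulP p (suc k) xs ys) (suc s ∷ α))
          (cong₂ _⊕_ (coeff-nth-map-mulP k x ys (suc s) α) (coeff-mulP k xs ys s α))

  mulP-vanishesˡ : ∀ k f g → Vanishes k f → Vanishes k (mulP p k f g)
  mulP-vanishesˡ zero    f g f≡𝟘 []      = trans (cong (_⊗ g) (f≡𝟘 [])) (zeroˡ g)
  mulP-vanishesˡ (suc k) f g f≡𝟘 (s ∷ α) = trans (coeff-mulP k f g s α)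
    (∑-zero {suc s} _ (λ i → mulP-vanishesˡ k (nth k f (toℕ i)) (nth k g (s ∸ toℕ i)) (λ β → f≡𝟘 (toℕ i ∷ β)) α))

  mulP-vanishesʳ : ∀ k f g → Vanishes k g → Vanishes k (mulP p k f g)
  mulP-vanishesʳ zero    f g g≡𝟘 []      = trans (cong (f ⊗_) (g≡𝟘 [])) (zeroʳ f)
  mulP-vanishesʳ (suc k) f g g≡𝟘 (s ∷ α) = trans (coeff-mulP k f g s α)
    (∑-zero {suc s} _ (λ i → mulP-vanishesʳ k (nth k f (toℕ i)) (nth k g (s ∸ toℕ i)) (λ β → g≡𝟘 (s ∸ toℕ i ∷ β)) α))

  mulP-identityˡ : ∀ k g → SameCoeffs k (mulP p k (oneP p k) g) g
  mulP-identityˡ zero    g []      = ⊗-identityˡ g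
  mulP-identityˡ (suc k) g (s ∷ α) = begin
    coeff (suc k) (mulP p (suc k) (oneP p (suc k)) g) (s ∷ α)  ≡⟨ coeff-mulP k (oneP p (suc k)) g s α ⟩
    ∑[ i < suc s ] term i                                     ≡⟨ ∑-head term (λ i → mulP-zeroˡ-vanishes k _ α) ⟩
    coeff k (mulP p k (oneP p k) (nth k g s)) α               ≡⟨ mulP-identityˡ k (nth k g s) α ⟩
    coeff k (nth k g s) α                                     ∎
    where
    open ≡-Reasoning
    term : Fin (suc s) → 𝔽
    term i = coeff k (mulP p k (nth k (oneP p (suc k)) (toℕ i)) (nth k g (s ∸ toℕ i))) α

  mulVar : ∀ k → Fin k → Poly p k → Poly p k
  mulVar (suc k) zero    f = zeroP p k ∷ f
  mulVar (suc k) (suc v) f = map (mulVar k v) f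

  mulVar-zeroP-vanishes : ∀ k v → Vanishes k (mulVar k v (zeroP p k))
  mulVar-zeroP-vanishes (suc k) zero    (zero ∷ α)  = zeroP-vanishes k α
  mulVar-zeroP-vanishes (suc k) zero    (suc s ∷ α) = zeroP-vanishes k α
  mulVar-zeroP-vanishes (suc k) (suc v) α           = zeroP-vanishes (suc k) α

  coeff-nth-map-mulVar : ∀ k v fs s α →
                         coeff k (nth k (map (mulVar k v) fs) s) α ≡ coeff k (mulVar k v (nth k fs s)) α
  coeff-nth-map-mulVar k v []       s       α = trans (zeroP-vanishes k α) (sym (mulVar-zeroP-vanishes k v α))
  coeff-nth-map-mulVar k v (f ∷ fs) zero    α = refl
  coeff-nth-map-mulVar k v (f ∷ fs) (suc s) α = coeff-nth-map-mulVar k v fs s α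

  mulP-var : ∀ k v f → SameCoeffs k (mulP p k (var p k v) f) (mulVar k v f)
  mulP-var (suc k) zero    f (zero ∷ α)  =
    trans (coeff-mulP k (var p (suc k) zero) f zero α)
          (trans (cong (_⊕ 𝟘) (mulP-zeroˡ-vanishes k (nth k f 0) α))
                 (trans (+-identityʳ 𝟘) (sym (zeroP-vanishes k α))))
  mulP-var (suc k) zero    f (suc s ∷ α) = begin
    coeff (suc k) (mulP p (suc k) (var p (suc k) zero) f) (suc s ∷ α)  ≡⟨ coeff-mulP k (var p (suc k) zero) f (suc s) α ⟩
    term zero ⊕ ∑[ i < suc s ] term (suc i)
      ≡⟨ cong (_⊕ ∑[ i < suc s ] term (suc i)) (mulP-zeroˡ-vanishes k (nth k f (suc s)) α) ⟩
    𝟘 ⊕ ∑[ i < suc s ] term (suc i)                  ≡⟨ ⊕-identityˡ _ ⟩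
    ∑[ i < suc s ] term (suc i)
      ≡⟨ ∑-head (term ∘ suc) (λ i → mulP-zeroˡ-vanishes k (nth k f (s ∸ suc (toℕ i))) α) ⟩
    coeff k (mulP p k (oneP p k) (nth k f s)) α      ≡⟨ mulP-identityˡ k (nth k f s) α ⟩
    coeff k (nth k f s) α                            ∎
    where
    open ≡-Reasoning
    term : Fin (suc (suc s)) → 𝔽
    term i = coeff k (mulP p k (nth k (var p (suc k) zero) (toℕ i)) (nth k f (suc s ∸ toℕ i))) α
  mulP-var (suc k) (suc v) f (s ∷ α) = begin
    coeff (suc k) (mulP p (suc k) (var p (suc k) (suc v)) f) (s ∷ α)  ≡⟨ coeff-mulP k (var p (suc k) (suc v)) f s α ⟩
    ∑[ i < suc s ] term i                              ≡⟨ ∑-head term (λ i → mulP-zeroˡ-vanishes k _ α) ⟩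
    coeff k (mulP p k (var p k v) (nth k f s)) α       ≡⟨ mulP-var k v (nth k f s) α ⟩
    coeff k (mulVar k v (nth k f s)) α                ≡⟨ coeff-nth-map-mulVar k v f s α ⟨
    coeff (suc k) (mulVar (suc k) (suc v) f) (s ∷ α)  ∎
    where
    open ≡-Reasoning
    term : Fin (suc s) → 𝔽
    term i = coeff k (mulP p k (nth k (var p (suc k) (suc v)) (toℕ i)) (nth k f (s ∸ toℕ i))) α

  coeff-mulVar-updateAt : ∀ k v f α → coeff k (mulVar k v f) (Vec.updateAt α v suc) ≡ coeff k f α
  coeff-mulVar-updateAt (suc k) zero    f (s ∷ α) = refl
  coeff-mulVar-updateAt (suc k) (suc v) f (s ∷ α) =
    trans (coeff-nth-map-mulVar k v f s _) (coeff-mulVar-updateAt k v (nth k f s) α)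

  coeff-mulVar-0 : ∀ k v f α → Vec.lookup α v ≡ 0 → coeff k (mulVar k v f) α ≡ 𝟘
  coeff-mulVar-0 (suc k) zero    f (zero ∷ α) _    = zeroP-vanishes k α
  coeff-mulVar-0 (suc k) (suc v) f (s ∷ α)    α≡0  =
    trans (coeff-nth-map-mulVar k v f s α) (coeff-mulVar-0 k v (nth k f s) α α≡0)


  addP-vanishesFrom : ∀ k {a} f g → VanishesFrom k a f → VanishesFrom k a g → VanishesFrom k a (addP p k f g)
  addP-vanishesFrom k f g vf vg α le = trans (coeff-addP k f g α) (trans (cong₂ _⊕_ (vf α le) (vg α le)) (+-identityʳ 𝟘))

  scaleP-vanishesFrom : ∀ k {a} c f → VanishesFrom k a f → VanishesFrom k a (scaleP p k c f)
  scaleP-vanishesFrom k c f vf α le = trans (coeff-scaleP k c f α) (trans (cong (c ⊗_) (vf α le)) (zeroʳ c))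

  sumP-vanishesFrom : ∀ k {a m} (fs : Fin m → Poly p k) → (∀ j → VanishesFrom k a (fs j)) →
                      VanishesFrom k a (sumP p k (tabulate fs))
  sumP-vanishesFrom k {m = zero}  fs vfs α le = zeroP-vanishes k α
  sumP-vanishesFrom k {m = suc m} fs vfs     =
    addP-vanishesFrom k (fs zero) _ (vfs zero) (sumP-vanishesFrom k (fs ∘ suc) (vfs ∘ suc))

  oneP-vanishesFrom : ∀ k d → VanishesFrom k (suc d) (oneP p k)
  oneP-vanishesFrom k d α le = coeff-constP-pos k 𝟙 α (ℕ.≤-trans (s≤s z≤n) le)

  sameCoeffs-vanishesFrom : ∀ k {a} f g → SameCoeffs k f g → VanishesFrom k a g → VanishesFrom k a f
  sameCoeffs-vanishesFrom k f g f≈g vg α le = trans (f≈g α) (vg α le)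


module Substitution (p : ℕ) .{{_ : NonZero p}} where

  open PrimeField p
  open Coefficients p

  coeff-substP-∷ : ∀ k {n} β c cs α →
                   coeff n (substP p (suc k) β (c ∷ cs)) α ≡
                   coeff n (substP p k (β ∘ suc) c) α ⊕ β zero ⊗ coeff n (substP p (suc k) β cs) α
  coeff-substP-∷ k {n} β c cs α =
    trans (coeff-addP n (substP p k (β ∘ suc) c) (scaleP p n (β zero) (substP p (suc k) β cs)) α)
          (cong (coeff n (substP p k (β ∘ suc) c) α ⊕_) (coeff-scaleP n (β zero) (substP p (suc k) β cs) α))

  substP-vanishes : ∀ k {n} β f → Vanishes (k ℕ.+ n) f → Vanishes n (substP p k β f)
  substP-vanishes zero        β f        f≡𝟘 = f≡𝟘
  substP-vanishes (suc k) {n} β []       _   α = zeroP-vanishes n α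
  substP-vanishes (suc k) {n} β (c ∷ cs) f≡𝟘 α = begin
    coeff n (substP p (suc k) β (c ∷ cs)) α                                    ≡⟨ coeff-substP-∷ k β c cs α ⟩
    coeff n (substP p k (β ∘ suc) c) α ⊕ β zero ⊗ coeff n (substP p (suc k) β cs) α
      ≡⟨ cong₂ (λ x y → x ⊕ β zero ⊗ y) (substP-vanishes k (β ∘ suc) c (λ γ → f≡𝟘 (zero ∷ γ)) α)
                                          (substP-vanishes (suc k) β cs (λ { (s ∷ γ) → f≡𝟘 (suc s ∷ γ) }) α) ⟩
    𝟘 ⊕ β zero ⊗ 𝟘                                                             ≡⟨ cong (𝟘 ⊕_) (zeroʳ (β zero)) ⟩
    𝟘 ⊕ 𝟘                                                                      ≡⟨ +-identityʳ 𝟘 ⟩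
    𝟘                                                                          ∎
    where open ≡-Reasoning

  substP-sameCoeffs : ∀ k {n} β f g → SameCoeffs (k ℕ.+ n) f g → SameCoeffs n (substP p k β f) (substP p k β g)
  substP-sameCoeffs zero        β f        g        f≈g = f≈g
  substP-sameCoeffs (suc k) {n} β []       []       _   α = refl
  substP-sameCoeffs (suc k) {n} β []       (y ∷ ys) f≈g α =
    trans (zeroP-vanishes n α)
          (sym (substP-vanishes (suc k) β (y ∷ ys) (λ γ → trans (sym (f≈g γ)) (zeroP-vanishes (suc k ℕ.+ n) γ)) α))
  substP-sameCoeffs (suc k) {n} β (x ∷ xs) []       f≈g α =
    trans (substP-vanishes (suc k) β (x ∷ xs) (λ γ → trans (f≈g γ) (zeroP-vanishes (suc k ℕ.+ n) γ)) α)
          (sym (zeroP-vanishes n α))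
  substP-sameCoeffs (suc k) {n} β (x ∷ xs) (y ∷ ys) f≈g α = begin
    coeff n (substP p (suc k) β (x ∷ xs)) α                                    ≡⟨ coeff-substP-∷ k β x xs α ⟩
    coeff n (substP p k (β ∘ suc) x) α ⊕ β zero ⊗ coeff n (substP p (suc k) β xs) α
      ≡⟨ cong₂ (λ a b → a ⊕ β zero ⊗ b) (substP-sameCoeffs k (β ∘ suc) x y (λ γ → f≈g (zero ∷ γ)) α)
                                          (substP-sameCoeffs (suc k) β xs ys (λ { (s ∷ γ) → f≈g (suc s ∷ γ) }) α) ⟩
    coeff n (substP p k (β ∘ suc) y) α ⊕ β zero ⊗ coeff n (substP p (suc k) β ys) α
      ≡⟨ coeff-substP-∷ k β y ys α ⟨
    coeff n (substP p (suc k) β (y ∷ ys)) α                                    ∎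
    where open ≡-Reasoning

  coeff-substP-addP : ∀ k {n} β f g α →
                      coeff n (substP p k β (addP p (k ℕ.+ n) f g)) α ≡
                      coeff n (substP p k β f) α ⊕ coeff n (substP p k β g) α
  coeff-substP-addP zero        β f        g        α = coeff-addP _ f g α
  coeff-substP-addP (suc k) {n} β []       ys       α =
    sym (trans (cong (_⊕ coeff n (substP p (suc k) β ys) α) (zeroP-vanishes n α)) (⊕-identityˡ _))
  coeff-substP-addP (suc k) {n} β (x ∷ xs) []       α =
    sym (trans (cong (coeff n (substP p (suc k) β (x ∷ xs)) α ⊕_) (zeroP-vanishes n α)) (+-identityʳ _))
  coeff-substP-addP (suc k) {n} β (x ∷ xs) (y ∷ ys) α = begin
    coeff n (substP p (suc k) β (addP p (suc k ℕ.+ n) (x ∷ xs) (y ∷ ys))) α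
      ≡⟨ coeff-substP-∷ k β (addP p (k ℕ.+ n) x y) (addP p (suc k ℕ.+ n) xs ys) α ⟩
    coeff n (substP p k β′ (addP p (k ℕ.+ n) x y)) α ⊕ z ⊗ coeff n (substP p (suc k) β (addP p (suc k ℕ.+ n) xs ys)) α
      ≡⟨ cong₂ (λ a b → a ⊕ z ⊗ b) (coeff-substP-addP k β′ x y α) (coeff-substP-addP (suc k) β xs ys α) ⟩
    (X ⊕ Y) ⊕ z ⊗ (XS ⊕ YS)        ≡⟨ cong (X ⊕ Y ⊕_) (distribˡ z XS YS) ⟩
    (X ⊕ Y) ⊕ (z ⊗ XS ⊕ z ⊗ YS)    ≡⟨ ⊕-interchange X Y (z ⊗ XS) (z ⊗ YS) ⟩
    (X ⊕ z ⊗ XS) ⊕ (Y ⊕ z ⊗ YS)    ≡⟨ cong₂ _⊕_ (coeff-substP-∷ k β x xs α) (coeff-substP-∷ k β y ys α) ⟨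
    coeff n (substP p (suc k) β (x ∷ xs)) α ⊕ coeff n (substP p (suc k) β (y ∷ ys)) α ∎
    where
    open ≡-Reasoning
    β′ = β ∘ suc
    z = β zero
    X = coeff n (substP p k β′ x) α
    Y = coeff n (substP p k β′ y) α
    XS = coeff n (substP p (suc k) β xs) α
    YS = coeff n (substP p (suc k) β ys) α

  coeff-substP-scaleP : ∀ k {n} β c f α →
                        coeff n (substP p k β (scaleP p (k ℕ.+ n) c f)) α ≡ c ⊗ coeff n (substP p k β f) α
  coeff-substP-scaleP zero        β c f        α = coeff-scaleP _ c f α
  coeff-substP-scaleP (suc k) {n} β c []       α =
    trans (zeroP-vanishes n α) (sym (trans (cong (c ⊗_) (zeroP-vanishes n α)) (zeroʳ c)))
  coeff-substP-scaleP (suc k) {n} β c (x ∷ xs) α = begin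
    coeff n (substP p (suc k) β (scaleP p (suc k ℕ.+ n) c (x ∷ xs))) α
      ≡⟨ coeff-substP-∷ k β (scaleP p (k ℕ.+ n) c x) (scaleP p (suc k ℕ.+ n) c xs) α ⟩
    coeff n (substP p k β′ (scaleP p (k ℕ.+ n) c x)) α ⊕ z ⊗ coeff n (substP p (suc k) β (scaleP p (suc k ℕ.+ n) c xs)) α
      ≡⟨ cong₂ (λ a b → a ⊕ z ⊗ b) (coeff-substP-scaleP k β′ c x α) (coeff-substP-scaleP (suc k) β c xs α) ⟩
    c ⊗ X ⊕ z ⊗ (c ⊗ XS)     ≡⟨ cong (c ⊗ X ⊕_) (⊗-left-comm z c XS) ⟩
    c ⊗ X ⊕ c ⊗ (z ⊗ XS)     ≡⟨ distribˡ c X (z ⊗ XS) ⟨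
    c ⊗ (X ⊕ z ⊗ XS)         ≡⟨ cong (c ⊗_) (coeff-substP-∷ k β x xs α) ⟨
    c ⊗ coeff n (substP p (suc k) β (x ∷ xs)) α ∎
    where
    open ≡-Reasoning
    β′ = β ∘ suc
    z = β zero
    X = coeff n (substP p k β′ x) α
    XS = coeff n (substP p (suc k) β xs) α

  coeff-substP-mulVar : ∀ k {n} β (w : Fin k) f α →
                        coeff n (substP p k β (mulVar (k ℕ.+ n) (w ↑ˡ n) f)) α ≡ β w ⊗ coeff n (substP p k β f) α
  coeff-substP-mulVar (suc k) {n} β zero    f        α = begin
    coeff n (substP p (suc k) β (zeroP p (k ℕ.+ n) ∷ f)) α
      ≡⟨ coeff-substP-∷ k β (zeroP p (k ℕ.+ n)) f α ⟩
    coeff n (substP p k (β ∘ suc) (zeroP p (k ℕ.+ n))) α ⊕ β zero ⊗ coeff n (substP p (suc k) β f) α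
      ≡⟨ cong (_⊕ β zero ⊗ coeff n (substP p (suc k) β f) α)
              (substP-vanishes k (β ∘ suc) (zeroP p (k ℕ.+ n)) (zeroP-vanishes (k ℕ.+ n)) α) ⟩
    𝟘 ⊕ β zero ⊗ coeff n (substP p (suc k) β f) α
      ≡⟨ ⊕-identityˡ _ ⟩
    β zero ⊗ coeff n (substP p (suc k) β f) α ∎
    where open ≡-Reasoning
  coeff-substP-mulVar (suc k) {n} β (suc w) []       α =
    trans (zeroP-vanishes n α) (sym (trans (cong (β (suc w) ⊗_) (zeroP-vanishes n α)) (zeroʳ (β (suc w)))))
  coeff-substP-mulVar (suc k) {n} β (suc w) (x ∷ xs) α = begin
    coeff n (substP p (suc k) β (mulVar (suc k ℕ.+ n) (suc w ↑ˡ n) (x ∷ xs))) α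
      ≡⟨ coeff-substP-∷ k β (mulVar (k ℕ.+ n) (w ↑ˡ n) x) (mulVar (suc k ℕ.+ n) (suc w ↑ˡ n) xs) α ⟩
    coeff n (substP p k β′ (mulVar (k ℕ.+ n) (w ↑ˡ n) x)) α
      ⊕ z ⊗ coeff n (substP p (suc k) β (mulVar (suc k ℕ.+ n) (suc w ↑ˡ n) xs)) α
      ≡⟨ cong₂ (λ a b → a ⊕ z ⊗ b) (coeff-substP-mulVar k β′ w x α) (coeff-substP-mulVar (suc k) β (suc w) xs α) ⟩
    c ⊗ X ⊕ z ⊗ (c ⊗ XS)     ≡⟨ cong (c ⊗ X ⊕_) (⊗-left-comm z c XS) ⟩
    c ⊗ X ⊕ c ⊗ (z ⊗ XS)     ≡⟨ distribˡ c X (z ⊗ XS) ⟨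
    c ⊗ (X ⊕ z ⊗ XS)         ≡⟨ cong (c ⊗_) (coeff-substP-∷ k β x xs α) ⟨
    c ⊗ coeff n (substP p (suc k) β (x ∷ xs)) α ∎
    where
    open ≡-Reasoning
    β′ = β ∘ suc
    z = β zero
    c = β (suc w)
    X = coeff n (substP p k β′ x) α
    XS = coeff n (substP p (suc k) β xs) α

  coeff-substP-sumP : ∀ k {n m} β (fs : Fin m → Poly p (k ℕ.+ n)) α →
                      coeff n (substP p k β (sumP p (k ℕ.+ n) (tabulate fs))) α ≡ ∑[ j < m ] coeff n (substP p k β (fs j)) α
  coeff-substP-sumP k {n} {zero}  β fs α = substP-vanishes k β (zeroP p (k ℕ.+ n)) (zeroP-vanishes (k ℕ.+ n)) α
  coeff-substP-sumP k {n} {suc m} β fs α =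
    trans (coeff-substP-addP k β (fs zero) (sumP p (k ℕ.+ n) (tabulate (fs ∘ suc))) α)
          (cong (coeff n (substP p k β (fs zero)) α ⊕_) (coeff-substP-sumP k β (fs ∘ suc) α))

  substP-embP : ∀ k {n} β (f : Poly p n) → substP p k β (embP p k f) ≡ f
  substP-embP zero        β f = refl
  substP-embP (suc k) {n} β f =
    trans (cong₂ (addP p n) (substP-embP k (β ∘ suc) f) (scaleP-zeroP n (β zero))) (addP-zeroP n f)
    where
    scaleP-zeroP : ∀ n c → scaleP p n c (zeroP p n) ≡ zeroP p n
    scaleP-zeroP zero    c = zeroʳ c
    scaleP-zeroP (suc n) c = refl
    addP-zeroP : ∀ n f → addP p n f (zeroP p n) ≡ f
    addP-zeroP zero    f        = +-identityʳ f
    addP-zeroP (suc n) []       = refl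
    addP-zeroP (suc n) (x ∷ xs) = refl

  substP-oneP : ∀ k {n} β → substP p k β (oneP p (k ℕ.+ n)) ≡ oneP p n
  substP-oneP k {n} β = trans (cong (substP p k β) (constP-embP k)) (substP-embP k β (oneP p n))
    where
    constP-embP : ∀ k → constP p (k ℕ.+ n) 𝟙 ≡ embP p k (oneP p n)
    constP-embP zero    = refl
    constP-embP (suc k) = cong (_∷ []) (constP-embP k)

module LinearFunctional (p : ℕ) .{{_ : NonZero p}} {n d : ℕ} {ω : Poly p n → Fp p} (lin : IsLinearOn p n d ω) where

  open PrimeField p
  open Coefficients p
  open IsLinearOn lin

  Deg≤d : Poly p n → Set
  Deg≤d = VanishesFrom n (suc d)

  ω-resp : ∀ {f g} → Deg≤d f → Deg≤d g → SameCoeffs n f g → ω f ≡ ω g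
  ω-resp {f} {g} lf lg f≈g =
    resp f g (vanishesFrom⇒DegLe n d f lf) (vanishesFrom⇒DegLe n d g lg) (sameCoeffs⇒EqP n f g f≈g)

  ω-addP : ∀ {f g} → Deg≤d f → Deg≤d g → ω (addP p n f g) ≡ ω f ⊕ ω g
  ω-addP {f} {g} lf lg = add f g (vanishesFrom⇒DegLe n d f lf) (vanishesFrom⇒DegLe n d g lg)

  ω-scaleP : ∀ c {f} → Deg≤d f → ω (scaleP p n c f) ≡ c ⊗ ω f
  ω-scaleP c {f} lf = homog c f (vanishesFrom⇒DegLe n d f lf)

  ω-zeroP : ω (zeroP p n) ≡ 𝟘
  ω-zeroP = begin
    ω (zeroP p n)            ≡⟨ ω-resp (λ α _ → zeroP-vanishes n α) (scaleP-vanishesFrom n 𝟘 _ (λ α _ → zeroP-vanishes n α))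
                                       (λ α → trans (zeroP-vanishes n α) (sym (trans (coeff-scaleP n 𝟘 (zeroP p n) α) (zeroˡ _)))) ⟩
    ω (scaleP p n 𝟘 (zeroP p n)) ≡⟨ ω-scaleP 𝟘 (λ α _ → zeroP-vanishes n α) ⟩
    𝟘 ⊗ ω (zeroP p n)        ≡⟨ zeroˡ _ ⟩
    𝟘                        ∎
    where open ≡-Reasoning

  ω-sumP : ∀ {m} (fs : Fin m → Poly p n) → (∀ j → Deg≤d (fs j)) → ω (sumP p n (tabulate fs)) ≡ ∑[ j < m ] ω (fs j)
  ω-sumP {zero}  fs lfs = ω-zeroP
  ω-sumP {suc m} fs lfs =
    trans (ω-addP (lfs zero) (sumP-vanishesFrom n (fs ∘ suc) (lfs ∘ suc)))
          (cong (ω (fs zero) ⊕_) (ω-sumP (fs ∘ suc) (lfs ∘ suc)))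


module Degree (p : ℕ) .{{_ : NonZero p}} where

  open PrimeField p
  open Coefficients p

  HasTerm : ∀ k → ℕ → Poly p k → Set
  HasTerm k a f = ∃ λ α → Vec.sum α ≡ a × coeff k f α ≢ 𝟘

  HasDegree : ∀ k → ℕ → Poly p k → Set
  HasDegree k a f = VanishesFrom k (suc a) f × HasTerm k a f

  Nonvanishing : ∀ k → Poly p k → Set
  Nonvanishing k f = ∃ λ α → coeff k f α ≢ 𝟘

  hasTerm⇒≤ : ∀ k {a d} f → VanishesFrom k (suc d) f → HasTerm k a f → a ≤ d
  hasTerm⇒≤ k f vf (α , refl , nz) = ℕ.≮⇒≥ (λ d<|α| → nz (vf α d<|α|))

  vanishesFrom-strict : ∀ k {a} f → VanishesFrom k (suc a) f → ¬ HasTerm k a f → VanishesFrom k a f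
  vanishesFrom-strict k f vf ¬t α a≤|α| with ℕ.m≤n⇒m<n∨m≡n a≤|α| | coeff k f α ≟ 𝟘
  ... | inj₁ a<|α| | _      = vf α a<|α|
  ... | inj₂ _     | yes ≡𝟘 = ≡𝟘
  ... | inj₂ a≡|α| | no ≢𝟘  = contradiction (α , sym a≡|α| , ≢𝟘) ¬t

  nth-vanishesFrom : ∀ k {a} f → VanishesFrom (suc k) (suc a) f → ∀ i → VanishesFrom k (suc (a ∸ i)) (nth k f i)
  nth-vanishesFrom k {a} f vf i β le = vf (i ∷ β) (begin
    suc a                  ≤⟨ s≤s (ℕ.m≤n+m∸n a i) ⟩
    suc (i ℕ.+ (a ∸ i))    ≡⟨ ℕ.+-suc i (a ∸ i) ⟨
    i ℕ.+ suc (a ∸ i)      ≤⟨ ℕ.+-monoʳ-≤ i le ⟩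
    i ℕ.+ Vec.sum β        ∎)
    where open ℕ.≤-Reasoning

  hasTerm-nth : ∀ k {a} f → HasTerm (suc k) a f → ∃ λ i → i ≤ a × HasTerm k (a ∸ i) (nth k f i)
  hasTerm-nth k f (i ∷ β , i+|β|≡a , nz) =
    i , subst (i ≤_) i+|β|≡a (ℕ.m≤m+n i _) , β , trans (sym (ℕ.m+n∸m≡n i _)) (cong (_∸ i) i+|β|≡a) , nz

  nth-hasTerm : ∀ k {a i} f → i ≤ a → HasTerm k (a ∸ i) (nth k f i) → HasTerm (suc k) a f
  nth-hasTerm k {i = i} f i≤a (β , |β|≡a∸i , nz) = i ∷ β , trans (cong (i ℕ.+_) |β|≡a∸i) (ℕ.m+[n∸m]≡n i≤a) , nz

  hasTerm? : ∀ k a f → Dec (HasTerm k a f)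
  hasTerm? zero    a c with 0 ℕ.≟ a | c ≟ 𝟘
  ... | yes 0≡a | no c≢𝟘  = yes ([] , 0≡a , c≢𝟘)
  ... | yes _   | yes c≡𝟘 = no λ { ([] , _ , c≢𝟘) → c≢𝟘 c≡𝟘 }
  ... | no 0≢a  | _       = no λ { ([] , 0≡a , _) → 0≢a 0≡a }
  hasTerm? (suc k) a f =
    map′ (λ { (i , s≤s i≤a , t) → nth-hasTerm k f i≤a t })
         (λ t → let i , i≤a , tᵢ = hasTerm-nth k f t in i , s≤s i≤a , tᵢ)
         (ℕ.anyUpTo? (λ i → hasTerm? k (a ∸ i) (nth k f i)) (suc a))

  degreeBound : ∀ k → Poly p k → ℕ
  degreeBound zero    c        = 0
  degreeBound (suc k) []       = 0
  degreeBound (suc k) (c ∷ cs) = degreeBound k c ℕ.⊔ suc (degreeBound (suc k) cs)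

  vanishesFrom-degreeBound : ∀ k f → VanishesFrom k (suc (degreeBound k f)) f
  vanishesFrom-degreeBound (suc k) []       (s ∷ α)     _  = zeroP-vanishes k α
  vanishesFrom-degreeBound (suc k) (c ∷ cs) (zero ∷ α)  le =
    vanishesFrom-degreeBound k c α (ℕ.≤-trans (s≤s (ℕ.m≤m⊔n _ _)) le)
  vanishesFrom-degreeBound (suc k) (c ∷ cs) (suc s ∷ α) le =
    vanishesFrom-degreeBound (suc k) cs (s ∷ α) (ℕ.≤-trans (ℕ.m≤n⊔m (degreeBound k c) _) (ℕ.≤-pred le))

  nonvanishing⇒hasDegree : ∀ k f → Nonvanishing k f → ∃ λ a → HasDegree k a f
  nonvanishing⇒hasDegree k f (α , nz)
    with a , _ , tₐ , above ← greatest-≤ (λ a → hasTerm? k a f) (degreeBound k f)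
                                (hasTerm⇒≤ k f (vanishesFrom-degreeBound k f) (α , refl , nz)) (α , refl , nz)
    = a , vanishes-above , tₐ
    where
    below : ∀ {a} → HasTerm k a f → a ≤ degreeBound k f
    below = hasTerm⇒≤ k f (vanishesFrom-degreeBound k f)
    vanishes-above : VanishesFrom k (suc a) f
    vanishes-above β a<|β| = decidable-stable (coeff k f β ≟ 𝟘)
      (λ nz′ → above a<|β| (below (β , refl , nz′)) (β , refl , nz′))

  vanishes⊎nonvanishing : ∀ k f → Vanishes k f ⊎ Nonvanishing k f
  vanishes⊎nonvanishing k f with ℕ.anyUpTo? (λ a → hasTerm? k a f) (suc (degreeBound k f))
  ... | yes (_ , _ , α , _ , nz) = inj₂ (α , nz)
  ... | no none = inj₁ λ α → decidable-stable (coeff k f α ≟ 𝟘)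
      (λ nz → none (Vec.sum α , s≤s (hasTerm⇒≤ k f (vanishesFrom-degreeBound k f) (α , refl , nz)) , α , refl , nz))

  -- deg f < a and deg g < b give deg (f g) < a + b - 1, stated without truncated subtraction.
  mulP-vanishesFrom : ∀ k {a b} f g → VanishesFrom k a f → VanishesFrom k b g →
                      ∀ α → a ℕ.+ b ≤ suc (Vec.sum α) → coeff k (mulP p k f g) α ≡ 𝟘
  mulP-vanishesFrom zero {zero}          f g vf vg [] _          = trans (cong (_⊗ g) (vf [] z≤n)) (zeroˡ g)
  mulP-vanishesFrom zero {suc a} {zero}  f g vf vg [] _          = trans (cong (f ⊗_) (vg [] z≤n)) (zeroʳ f)
  mulP-vanishesFrom zero {suc a} {suc b} f g vf vg [] (s≤s le)   =
    contradiction (subst (_≤ 0) (ℕ.+-suc a b) le) λ ()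
  mulP-vanishesFrom (suc k) {a} {b} f g vf vg (s ∷ α) bound =
    trans (coeff-mulP k f g s α) (∑-zero {suc s} _ term≡𝟘)
    where
    term≡𝟘 : ∀ (i : Fin (suc s)) → coeff k (mulP p k (nth k f (toℕ i)) (nth k g (s ∸ toℕ i))) α ≡ 𝟘
    term≡𝟘 i with a ℕ.≤? toℕ i | b ℕ.≤? s ∸ toℕ i
    ... | yes a≤i | _       =
      mulP-vanishesˡ k _ _ (λ β → vf (toℕ i ∷ β) (ℕ.≤-trans a≤i (ℕ.m≤m+n _ _))) α
    ... | no _    | yes b≤j =
      mulP-vanishesʳ k _ _ (λ β → vg (s ∸ toℕ i ∷ β) (ℕ.≤-trans b≤j (ℕ.m≤m+n _ _))) α
    ... | no a≰i  | no b≰j  =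
      mulP-vanishesFrom k (nth k f (toℕ i)) (nth k g (s ∸ toℕ i))
        (λ β le → vf (toℕ i ∷ β) (m∸n≤o⇒m≤n+o le))
        (λ β le → vg (s ∸ toℕ i ∷ β) (m∸n≤o⇒m≤n+o le))
        α (∸-+-≤ (ℕ.<⇒≤ (ℕ.≰⇒> a≰i)) (ℕ.<⇒≤ (ℕ.≰⇒> b≰j))
                 (subst (λ x → a ℕ.+ b ≤ suc (x ℕ.+ Vec.sum α)) (sym (ℕ.m+[n∸m]≡n (ℕ.≤-pred (toℕ<n i)))) bound))

  -- For f of total degree a, i₀ is the largest power of the outermost variable y occurring in a
  -- monomial of f of degree a.
  TopSlice : ∀ k → ℕ → Poly p (suc k) → ℕ → Set
  TopSlice k a f i₀ = i₀ ≤ a × HasDegree k (a ∸ i₀) (nth k f i₀) ×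
                      (∀ {i} → i₀ < i → i ≤ a → VanishesFrom k (a ∸ i) (nth k f i))

  topSlice : ∀ k {a} f → HasDegree (suc k) a f → ∃ (TopSlice k a f)
  topSlice k {a} f (vf , tf)
    with i₁ , i₁≤a , t₁ ← hasTerm-nth k f tf
    with i₀ , i₀≤a , t₀ , above ← greatest-≤ (λ i → hasTerm? k (a ∸ i) (nth k f i)) a i₁≤a t₁
    = i₀ , i₀≤a , (nth-vanishesFrom k f vf i₀ , t₀) ,
      λ {i} i₀<i i≤a → vanishesFrom-strict k (nth k f i) (nth-vanishesFrom k f vf i) (above i₀<i i≤a)

  crossTerm-vanishes : ∀ k {a b i₀ j₀} f g → VanishesFrom (suc k) (suc a) f → VanishesFrom (suc k) (suc b) g →
                       TopSlice k a f i₀ → TopSlice k b g j₀ →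
                       ∀ {i j} α → i ℕ.+ j ≡ i₀ ℕ.+ j₀ → i ≢ i₀ → Vec.sum α ≡ (a ∸ i₀) ℕ.+ (b ∸ j₀) →
                       coeff k (mulP p k (nth k f i) (nth k g j)) α ≡ 𝟘
  crossTerm-vanishes k {a} {b} {i₀} {j₀} f g vf vg (i₀≤a , _ , above-f) (j₀≤b , _ , above-g) {i} {j} α i+j≡ i≢i₀ |α|≡
    with ℕ.<-cmp i _
  ... | tri≈ _ i≡i₀ _ = contradiction i≡i₀ i≢i₀
  ... | tri> _ _ i₀<i with i ℕ.≤? a
  ...   | no i≰a = mulP-vanishesˡ k _ _ (λ β → vf (i ∷ β) (ℕ.≤-trans (ℕ.≰⇒> i≰a) (ℕ.m≤m+n i _))) α
  ...   | yes i≤a = mulP-vanishesFrom k _ _ (above-f i₀<i i≤a) (nth-vanishesFrom k g vg j) α (ℕ.≤-reflexive (begin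
          (a ∸ i) ℕ.+ suc (b ∸ j)      ≡⟨ ℕ.+-suc (a ∸ i) (b ∸ j) ⟩
          suc ((a ∸ i) ℕ.+ (b ∸ j))    ≡⟨ cong suc (∸-balance i≤a (ℕ.<⇒≤ (ℕ.<-≤-trans j<j₀ j₀≤b)) i₀≤a j₀≤b i+j≡) ⟩
          suc ((a ∸ i₀) ℕ.+ (b ∸ j₀))  ≡⟨ cong suc |α|≡ ⟨
          suc (Vec.sum α)              ∎))
    where
    open ≡-Reasoning
    j<j₀ = +-≡-<-swap i+j≡ i₀<i
  crossTerm-vanishes k {a} {b} {i₀} {j₀} f g vf vg (i₀≤a , _ , above-f) (j₀≤b , _ , above-g) {i} {j} α i+j≡ i≢i₀ |α|≡
      | tri< i<i₀ _ _ with j ℕ.≤? b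
  ...   | no j≰b = mulP-vanishesʳ k _ _ (λ β → vg (j ∷ β) (ℕ.≤-trans (ℕ.≰⇒> j≰b) (ℕ.m≤m+n j _))) α
  ...   | yes j≤b = mulP-vanishesFrom k _ _ (nth-vanishesFrom k f vf i) (above-g j₀<j j≤b) α (ℕ.≤-reflexive (begin
          suc ((a ∸ i) ℕ.+ (b ∸ j))    ≡⟨ cong suc (∸-balance (ℕ.<⇒≤ (ℕ.<-≤-trans i<i₀ i₀≤a)) j≤b i₀≤a j₀≤b i+j≡) ⟩
          suc ((a ∸ i₀) ℕ.+ (b ∸ j₀))  ≡⟨ cong suc |α|≡ ⟨
          suc (Vec.sum α)              ∎))
    where
    open ≡-Reasoning
    j₀<j = +-≡-<-swap (sym i+j≡) i<i₀

  embP-hasDegree : ∀ j {n a} (f : Poly p n) → HasDegree n a f → HasDegree (j ℕ.+ n) a (embP p j f)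
  embP-hasDegree j {n} {a} f (vf , β , |β|≡a , nz) = vanishes , term
    where
    vanishes : VanishesFrom (j ℕ.+ n) (suc a) (embP p j f)
    vanishes α a<|α| with γ , α′ , refl ← Vec.splitAt j α with Vec.sum γ in |γ|≡
    ... | zero  = trans (coeff-embP j f γ α′) (trans (coeff-constP-0 j _ γ |γ|≡)
                    (vf α′ (subst (suc a ≤_) (trans (Vec.sum-++ γ) (cong (ℕ._+ Vec.sum α′) |γ|≡)) a<|α|)))
    ... | suc _ = trans (coeff-embP j f γ α′) (coeff-constP-pos j _ γ (subst (0 <_) (sym |γ|≡) (s≤s z≤n)))
    term : HasTerm (j ℕ.+ n) a (embP p j f)
    term = Vec.replicate j 0 ++ β ,
           trans (Vec.sum-++ (Vec.replicate j 0)) (trans (cong (ℕ._+ Vec.sum β) (sum-zeros j)) |β|≡a) ,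
           λ coeff≡𝟘 → nz (trans (sym (coeff-constP-0 j _ _ (sum-zeros j)))
                                 (trans (sym (coeff-embP j f (Vec.replicate j 0) β)) coeff≡𝟘))

  module _ (p-prime : Prime p) where

    -- Total degree is additive: if x^α is a top monomial of (slice i₀ of f)(slice j₀ of g), then in
    -- f g the monomial y^(i₀+j₀) x^α receives no other contribution (crossTerm-vanishes).
    mulP-hasTerm : ∀ k {a b} f g → HasDegree k a f → HasDegree k b g → HasTerm k (a ℕ.+ b) (mulP p k f g)
    mulP-hasTerm zero f g (_ , [] , refl , f≢𝟘) (_ , [] , refl , g≢𝟘) = [] , refl , ⊗-nonzero p-prime f≢𝟘 g≢𝟘
    mulP-hasTerm (suc k) {a} {b} f g df@(vf , _) dg@(vg , _)
      with i₀ , sf@(i₀≤a , dfᵢ₀ , _) ← topSlice k f df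
         | j₀ , sg@(j₀≤b , dgⱼ₀ , _) ← topSlice k g dg
      with α , |α|≡ , coeffᵢ₀ⱼ₀≢𝟘 ← mulP-hasTerm k (nth k f i₀) (nth k g j₀) dfᵢ₀ dgⱼ₀
      = s₀ ∷ α , trans (cong (s₀ ℕ.+_) |α|≡) (∸-+-split i₀≤a j₀≤b) , coeff≢𝟘
      where
      open ≡-Reasoning
      s₀ = i₀ ℕ.+ j₀
      term : Fin (suc s₀) → 𝔽
      term i = coeff k (mulP p k (nth k f (toℕ i)) (nth k g (s₀ ∸ toℕ i))) α
      i₀′ : Fin (suc s₀)
      i₀′ = Fin.fromℕ< (s≤s (ℕ.m≤m+n i₀ j₀))
      toℕ-i₀′ : toℕ i₀′ ≡ i₀
      toℕ-i₀′ = toℕ-fromℕ< _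
      others : ∀ i → i ≢ i₀′ → term i ≡ 𝟘
      others i i≢i₀′ = crossTerm-vanishes k f g vf vg sf sg α (ℕ.m+[n∸m]≡n (ℕ.≤-pred (toℕ<n i)))
        (λ i≡i₀ → i≢i₀′ (toℕ-injective (trans i≡i₀ (sym toℕ-i₀′)))) |α|≡
      coeff≢𝟘 : coeff (suc k) (mulP p (suc k) f g) (s₀ ∷ α) ≢ 𝟘
      coeff≢𝟘 coeff≡𝟘 = coeffᵢ₀ⱼ₀≢𝟘 (begin
        coeff k (mulP p k (nth k f i₀) (nth k g j₀)) α
          ≡⟨ cong₂ (λ i j → coeff k (mulP p k (nth k f i) (nth k g j)) α)
                   (sym toℕ-i₀′) (trans (sym (ℕ.m+n∸m≡n i₀ j₀)) (cong (s₀ ∸_) (sym toℕ-i₀′))) ⟩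
        term i₀′                                   ≡⟨ ∑-single term i₀′ others ⟨
        ∑[ i < suc s₀ ] term i                     ≡⟨ coeff-mulP k f g s₀ α ⟨
        coeff (suc k) (mulP p (suc k) f g) (s₀ ∷ α) ≡⟨ coeff≡𝟘 ⟩
        𝟘                                          ∎)

    mulP-hasDegree : ∀ k {a b} f g → HasDegree k a f → HasDegree k b g → HasDegree k (a ℕ.+ b) (mulP p k f g)
    mulP-hasDegree k {a} {b} f g df@(vf , _) dg@(vg , _) =
      (λ α a+b<|α| → mulP-vanishesFrom k f g vf vg α
                       (subst (_≤ suc (Vec.sum α)) (sym (cong suc (ℕ.+-suc a b))) (s≤s a+b<|α|))) ,
      mulP-hasTerm k f g df dg

    oneP-hasDegree : ∀ k → HasDegree k 0 (oneP p k)
    oneP-hasDegree k =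
      (λ α 0<|α| → coeff-constP-pos k 𝟙 α 0<|α|) ,
      Vec.replicate k 0 , sum-zeros k ,
      λ coeff≡𝟘 → 𝟙≢𝟘 p-prime (trans (sym (coeff-constP-0 k 𝟙 _ (sum-zeros k))) coeff≡𝟘)

    prodP-hasDegree : ∀ k fs → All (Nonvanishing k) fs → ∃ λ a → HasDegree k a (prodP p k fs)
    prodP-hasDegree k []       []         = 0 , oneP-hasDegree k
    prodP-hasDegree k (f ∷ fs) (nf ∷ nfs)
      with a , df ← nonvanishing⇒hasDegree k f nf | b , dfs ← prodP-hasDegree k fs nfs
      = a ℕ.+ b , mulP-hasDegree k f (prodP p k fs) df dfs

    prodP-hasDegree-≥ : ∀ k {a f} fs → f ∈ fs → All (Nonvanishing k) fs → HasDegree k a f →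
                        ∃ λ d → a ≤ d × HasDegree k d (prodP p k fs)
    prodP-hasDegree-≥ k {a} (f ∷ fs) (here refl) (_ ∷ nfs) df
      with b , dfs ← prodP-hasDegree k fs nfs
      = a ℕ.+ b , ℕ.m≤m+n a b , mulP-hasDegree k f (prodP p k fs) df dfs
    prodP-hasDegree-≥ k (f′ ∷ fs) (there f∈fs) (nf′ ∷ nfs) df
      with c , df′ ← nonvanishing⇒hasDegree k f′ nf′ | d , a≤d , dfs ← prodP-hasDegree-≥ k fs f∈fs nfs df
      = c ℕ.+ d , ℕ.≤-trans a≤d (ℕ.m≤n+m d c) , mulP-hasDegree k f′ (prodP p k fs) df′ dfs


module CompanionPolynomials (p : ℕ) .{{_ : NonZero p}} (p-prime : Prime p) {n m : ℕ} (h : ℕ) (g : Fin m → Poly p n) where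

  open PrimeField p
  open Coefficients p
  open Substitution p
  open Degree p
  open Companion p n m h g

  rIndex : Fin h → Fin m → Fin N
  rIndex u j = combine u j ↑ˡ n

  coeff-linFactor : ∀ u α → coeff N (linFactor u) α ≡
                    coeff N (oneP p N) α ⊕ ⊖ 𝟙 ⊗ ∑[ j < m ] coeff N (mulVar N (rIndex u j) (gE j)) α
  coeff-linFactor u α = begin
    coeff N (linFactor u) α
      ≡⟨ coeff-addP N (oneP p N) (negP p N (sumP p N (map rg (allFin m)))) α ⟩
    coeff N (oneP p N) α ⊕ coeff N (negP p N (sumP p N (map rg (allFin m)))) α
      ≡⟨ cong (coeff N (oneP p N) α ⊕_) (coeff-scaleP N (⊖ 𝟙) (sumP p N (map rg (allFin m))) α) ⟩
    coeff N (oneP p N) α ⊕ ⊖ 𝟙 ⊗ coeff N (sumP p N (map rg (allFin m))) α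
      ≡⟨ cong (λ fs → coeff N (oneP p N) α ⊕ ⊖ 𝟙 ⊗ coeff N (sumP p N fs) α) (map-tabulate id rg) ⟩
    coeff N (oneP p N) α ⊕ ⊖ 𝟙 ⊗ coeff N (sumP p N (tabulate rg)) α
      ≡⟨ cong (λ x → coeff N (oneP p N) α ⊕ ⊖ 𝟙 ⊗ x)
              (trans (coeff-sumP N rg α) (sum-cong-≗ (λ j → mulP-var N (rIndex u j) (gE j) α))) ⟩
    coeff N (oneP p N) α ⊕ ⊖ 𝟙 ⊗ ∑[ j < m ] coeff N (mulVar N (rIndex u j) (gE j)) α ∎
    where
    open ≡-Reasoning
    rg : Fin m → Poly p N
    rg j = mulP p N (r u j) (gE j)

  linFactor-nonvanishing : ∀ u → Nonvanishing N (linFactor u)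
  linFactor-nonvanishing u = 0⃗ , λ coeff≡𝟘 → 𝟙≢𝟘 p-prime (begin
    𝟙                                                                 ≡⟨ +-identityʳ 𝟙 ⟨
    𝟙 ⊕ 𝟘                                                             ≡⟨ cong (𝟙 ⊕_) (zeroʳ (⊖ 𝟙)) ⟨
    𝟙 ⊕ ⊖ 𝟙 ⊗ 𝟘
      ≡⟨ cong₂ (λ x y → x ⊕ ⊖ 𝟙 ⊗ y) (sym (coeff-constP-0 N 𝟙 0⃗ (sum-zeros N)))
               (sym (∑-zero _ (λ j → coeff-mulVar-0 N (rIndex u j) (gE j) 0⃗ (Vec.lookup-replicate (rIndex u j) 0)))) ⟩
    coeff N (oneP p N) 0⃗ ⊕ ⊖ 𝟙 ⊗ ∑[ j < m ] coeff N (mulVar N (rIndex u j) (gE j)) 0⃗ ≡⟨ coeff-linFactor u 0⃗ ⟨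
    coeff N (linFactor u) 0⃗                                           ≡⟨ coeff≡𝟘 ⟩
    𝟘                                                                 ∎)
    where
    open ≡-Reasoning
    0⃗ = Vec.replicate N 0

  linFactor-hasTerm : ∀ u j {b} → HasTerm n b (g j) → HasTerm N (suc b) (linFactor u)
  linFactor-hasTerm u j {b} (β , |β|≡b , gⱼβ≢𝟘) =
    α₁ , |α₁|≡ , λ coeff≡𝟘 → ⊗-nonzero p-prime (⊖𝟙≢𝟘 p-prime) gⱼβ≢𝟘 (begin
    ⊖ 𝟙 ⊗ coeff n (g j) β                                      ≡⟨ ⊕-identityˡ _ ⟨
    𝟘 ⊕ ⊖ 𝟙 ⊗ coeff n (g j) β
      ≡⟨ cong₂ (λ x y → x ⊕ ⊖ 𝟙 ⊗ y) (sym (coeff-constP-pos N 𝟙 α₁ (subst (0 <_) (sym |α₁|≡) (s≤s z≤n))))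
               (sym (trans (∑-single term j others) (trans (coeff-mulVar-updateAt N (rIndex u j) (gE j) α₀) gEⱼα₀≡))) ⟩
    coeff N (oneP p N) α₁ ⊕ ⊖ 𝟙 ⊗ ∑[ j′ < m ] term j′         ≡⟨ coeff-linFactor u α₁ ⟨
    coeff N (linFactor u) α₁                                   ≡⟨ coeff≡𝟘 ⟩
    𝟘                                                          ∎)
    where
    open ≡-Reasoning
    α₀ α₁ : Vec ℕ N
    α₀ = Vec.replicate (h ℕ.* m) 0 ++ β
    α₁ = Vec.updateAt α₀ (rIndex u j) suc
    |α₁|≡ : Vec.sum α₁ ≡ suc b
    |α₁|≡ = trans (sum-updateAt-suc α₀ (rIndex u j))
                  (cong suc (trans (Vec.sum-++ (Vec.replicate (h ℕ.* m) 0))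
                                   (trans (cong (ℕ._+ Vec.sum β) (sum-zeros (h ℕ.* m))) |β|≡b)))
    term : Fin m → 𝔽
    term j′ = coeff N (mulVar N (rIndex u j′) (gE j′)) α₁
    others : ∀ j′ → j′ ≢ j → term j′ ≡ 𝟘
    others j′ j′≢j = coeff-mulVar-0 N (rIndex u j′) (gE j′) α₁ (begin
      Vec.lookup α₁ (rIndex u j′)                     ≡⟨ Vec.lookup∘updateAt′ (rIndex u j′) (rIndex u j) rIndex≢ α₀ ⟩
      Vec.lookup α₀ (rIndex u j′)                     ≡⟨ Vec.lookup-++ˡ (Vec.replicate (h ℕ.* m) 0) β (combine u j′) ⟩
      Vec.lookup (Vec.replicate (h ℕ.* m) 0) (combine u j′) ≡⟨ Vec.lookup-replicate (combine u j′) 0 ⟩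
      0                                               ∎)
      where
      rIndex≢ : rIndex u j′ ≢ rIndex u j
      rIndex≢ eq = j′≢j (combine-injectiveʳ u j′ u j (↑ˡ-injective n _ _ eq))
    gEⱼα₀≡ : coeff N (gE j) α₀ ≡ coeff n (g j) β
    gEⱼα₀≡ = trans (coeff-embP (h ℕ.* m) (g j) (Vec.replicate (h ℕ.* m) 0) β)
                   (coeff-constP-0 (h ℕ.* m) _ _ (sum-zeros (h ℕ.* m)))

  linFactors-nonvanishing : All (Nonvanishing N) (map linFactor (allFin h))
  linFactors-nonvanishing = All.map⁺ (All.tabulate⁺ linFactor-nonvanishing)

  -- deg g_j < deg (linFactor u) ≤ deg (E i) ≤ d.
  DegLe-E⇒DegLe-g : ∀ {d} i → DegLe p N d (E i) → Nonvanishing n (g i) → Fin h → ∀ j → DegLe p n d (g j)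
  DegLe-E⇒DegLe-g {d} i degEᵢ nzᵢ u j with vanishes⊎nonvanishing n (g j)
  ... | inj₁ gⱼ≡𝟘 = vanishesFrom⇒DegLe n d (g j) (λ α _ → gⱼ≡𝟘 α)
  ... | inj₂ nzⱼ
    with b , vgⱼ , tgⱼ ← nonvanishing⇒hasDegree n (g j) nzⱼ
       | a , dgᵢ ← nonvanishing⇒hasDegree n (g i) nzᵢ
       | dᵤ , dLᵤ@(vLᵤ , _) ← nonvanishing⇒hasDegree N (linFactor u) (linFactor-nonvanishing u)
    with D , dᵤ≤D , dΠ ← prodP-hasDegree-≥ p-prime N (map linFactor (allFin h)) (∈-map⁺ linFactor (∈-allFin u))
                                           linFactors-nonvanishing dLᵤ
    = vanishesFrom⇒DegLe n d (g j) (λ α d<|α| → vgⱼ α (ℕ.≤-trans (s≤s b≤d) d<|α|))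
    where
    b<dᵤ : b < dᵤ
    b<dᵤ = hasTerm⇒≤ N (linFactor u) vLᵤ (linFactor-hasTerm u j tgⱼ)
    a+D≤d : a ℕ.+ D ≤ d
    a+D≤d = hasTerm⇒≤ N (E i) (DegLe⇒vanishesFrom N d (E i) degEᵢ)
                      (proj₂ (mulP-hasDegree p-prime N (gE i) _ (embP-hasDegree (h ℕ.* m) (g i) dgᵢ) dΠ))
    b≤d : b ≤ d
    b≤d = ℕ.≤-trans (ℕ.<⇒≤ b<dᵤ) (ℕ.≤-trans dᵤ≤D (ℕ.≤-trans (ℕ.m≤n+m D a) a+D≤d))

  module _ {d} {ω : Poly p n → 𝔽} (lin : IsLinearOn p n d ω) (deg-g : ∀ j → DegLe p n d (g j))
           (β : Fin (h ℕ.* m) → 𝔽) (u : Fin h) where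

    open LinearFunctional p lin

    bg : Fin m → Poly p n
    bg j = scaleP p n (β (combine u j)) (g j)

    linFactorᵝ : Poly p n
    linFactorᵝ = addP p n (oneP p n) (negP p n (sumP p n (tabulate bg)))

    coeff-linFactorᵝ : ∀ α → coeff n linFactorᵝ α ≡
                       coeff n (oneP p n) α ⊕ ⊖ 𝟙 ⊗ ∑[ j < m ] (β (combine u j) ⊗ coeff n (g j) α)
    coeff-linFactorᵝ α =
      trans (coeff-addP n (oneP p n) _ α)
            (cong (coeff n (oneP p n) α ⊕_)
                  (trans (coeff-scaleP n (⊖ 𝟙) _ α)
                         (cong (⊖ 𝟙 ⊗_) (trans (coeff-sumP n bg α)
                                               (sum-cong-≗ (λ j → coeff-scaleP n (β (combine u j)) (g j) α))))))

    substP-linFactor : SameCoeffs n (substP p (h ℕ.* m) β (linFactor u)) linFactorᵝ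
    substP-linFactor α = begin
      coeff n (substP p (h ℕ.* m) β (linFactor u)) α
        ≡⟨ coeff-substP-addP (h ℕ.* m) β (oneP p N) _ α ⟩
      coeff n (substP p (h ℕ.* m) β (oneP p N)) α ⊕ coeff n (substP p (h ℕ.* m) β (negP p N (sumP p N (map rg (allFin m))))) α
        ≡⟨ cong₂ _⊕_ (cong (λ f → coeff n f α) (substP-oneP (h ℕ.* m) β))
                     (coeff-substP-scaleP (h ℕ.* m) β (⊖ 𝟙) _ α) ⟩
      coeff n (oneP p n) α ⊕ ⊖ 𝟙 ⊗ coeff n (substP p (h ℕ.* m) β (sumP p N (map rg (allFin m)))) α
        ≡⟨ cong (λ fs → coeff n (oneP p n) α ⊕ ⊖ 𝟙 ⊗ coeff n (substP p (h ℕ.* m) β (sumP p N fs)) α) (map-tabulate id rg) ⟩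
      coeff n (oneP p n) α ⊕ ⊖ 𝟙 ⊗ coeff n (substP p (h ℕ.* m) β (sumP p N (tabulate rg))) α
        ≡⟨ cong (λ x → coeff n (oneP p n) α ⊕ ⊖ 𝟙 ⊗ x)
                (trans (coeff-substP-sumP (h ℕ.* m) β rg α) (sum-cong-≗ substP-rg)) ⟩
      coeff n (oneP p n) α ⊕ ⊖ 𝟙 ⊗ ∑[ j < m ] (β (combine u j) ⊗ coeff n (g j) α)
        ≡⟨ coeff-linFactorᵝ α ⟨
      coeff n linFactorᵝ α ∎
      where
      open ≡-Reasoning
      rg : Fin m → Poly p N
      rg j = mulP p N (r u j) (gE j)
      substP-rg : ∀ j → coeff n (substP p (h ℕ.* m) β (rg j)) α ≡ β (combine u j) ⊗ coeff n (g j) α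
      substP-rg j = begin
        coeff n (substP p (h ℕ.* m) β (rg j)) α
          ≡⟨ substP-sameCoeffs (h ℕ.* m) β (rg j) _ (mulP-var N (rIndex u j) (gE j)) α ⟩
        coeff n (substP p (h ℕ.* m) β (mulVar N (rIndex u j) (gE j))) α
          ≡⟨ coeff-substP-mulVar (h ℕ.* m) β (combine u j) (gE j) α ⟩
        β (combine u j) ⊗ coeff n (substP p (h ℕ.* m) β (gE j)) α
          ≡⟨ cong (λ f → β (combine u j) ⊗ coeff n f α) (substP-embP (h ℕ.* m) β (g j)) ⟩
        β (combine u j) ⊗ coeff n (g j) α ∎

    ω-substP-linFactor : ω (substP p (h ℕ.* m) β (linFactor u)) ≡
                         ω (oneP p n) ⊕ ∑[ j < m ] (β (combine u j) ⊗ (⊖ 𝟙 ⊗ ω (g j)))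
    ω-substP-linFactor = begin
      ω (substP p (h ℕ.* m) β (linFactor u))
        ≡⟨ ω-resp (sameCoeffs-vanishesFrom n _ _ substP-linFactor low-linFactorᵝ) low-linFactorᵝ substP-linFactor ⟩
      ω linFactorᵝ
        ≡⟨ ω-addP (oneP-vanishesFrom n d) low-negP ⟩
      ω (oneP p n) ⊕ ω (negP p n (sumP p n (tabulate bg)))
        ≡⟨ cong (ω (oneP p n) ⊕_) (ω-scaleP (⊖ 𝟙) low-sumP) ⟩
      ω (oneP p n) ⊕ ⊖ 𝟙 ⊗ ω (sumP p n (tabulate bg))
        ≡⟨ cong (λ x → ω (oneP p n) ⊕ ⊖ 𝟙 ⊗ x) (trans (ω-sumP bg low-bg) (sum-cong-≗ (λ j → ω-scaleP _ (low-g j)))) ⟩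
      ω (oneP p n) ⊕ ⊖ 𝟙 ⊗ ∑[ j < m ] (β (combine u j) ⊗ ω (g j))
        ≡⟨ cong (ω (oneP p n) ⊕_) (trans (*-distribˡ-sum {m} (⊖ 𝟙) (λ j → β (combine u j) ⊗ ω (g j)))
                                         (sum-cong-≗ (λ j → ⊗-left-comm (⊖ 𝟙) (β (combine u j)) (ω (g j))))) ⟩
      ω (oneP p n) ⊕ ∑[ j < m ] (β (combine u j) ⊗ (⊖ 𝟙 ⊗ ω (g j))) ∎
      where
      open ≡-Reasoning
      low-g : ∀ j → Deg≤d (g j)
      low-g j = DegLe⇒vanishesFrom n d (g j) (deg-g j)
      low-bg : ∀ j → Deg≤d (bg j)
      low-bg j = scaleP-vanishesFrom n _ (g j) (low-g j)
      low-sumP : Deg≤d (sumP p n (tabulate bg))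
      low-sumP = sumP-vanishesFrom n bg low-bg
      low-negP : Deg≤d (negP p n (sumP p n (tabulate bg)))
      low-negP = scaleP-vanishesFrom n (⊖ 𝟙) _ low-sumP
      low-linFactorᵝ : Deg≤d linFactorᵝ
      low-linFactorᵝ = addP-vanishesFrom n _ _ (oneP-vanishesFrom n d) low-negP


module Counting (p : ℕ) .{{_ : NonZero p}} where

  open PrimeField p

  -- Substitutions are functions, so predicates on them must respect pointwise equality.
  Extensional : ∀ {k} → ((Fin k → 𝔽) → Set) → Set
  Extensional P = ∀ {β β′} → (∀ i → β i ≡ β′ i) → P β → P β′

  count-allFns-suc : ∀ {k} {P : (Fin (suc k) → 𝔽) → Set} (P? : Decidable P) →
                     count P? (allFns p (suc k)) ≡ sumˡ (map (λ x → count (P? ∘ consF p x) (allFns p k)) (allFin p))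
  count-allFns-suc {k} P? =
    trans (count-concatMap P? (λ x → map (consF p x) (allFns p k)) (allFin p))
          (cong sumˡ (map-cong (λ x → count-map P? (consF p x) (allFns p k)) (allFin p)))

  length-allFin : length (allFin p) ≡ p
  length-allFin = length-tabulate id

  length-allFns : ∀ k → length (allFns p k) ≡ p ^ k
  length-allFns zero    = refl
  length-allFns (suc k) = begin
    length (allFns p (suc k))                                   ≡⟨ count-all (allFns p (suc k)) ⟨
    count (λ _ → yes tt) (allFns p (suc k))                     ≡⟨ count-allFns-suc (λ _ → yes tt) ⟩
    sumˡ (map (λ _ → count (λ _ → yes tt) (allFns p k)) (allFin p))
      ≡⟨ cong sumˡ (map-cong (λ _ → trans (count-all (allFns p k)) (length-allFns k)) (allFin p)) ⟩
    sumˡ (map (λ _ → p ^ k) (allFin p))                         ≡⟨ sum-map-const (p ^ k) (allFin p) ⟩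
    length (allFin p) ℕ.* p ^ k                                 ≡⟨ cong (ℕ._* p ^ k) length-allFin ⟩
    p ^ suc k                                                   ∎
    where
    open ≡-Reasoning
    count-all : ∀ {A : Set} (xs : List A) → count (λ _ → yes tt) xs ≡ length xs
    count-all xs = trans (count-const (yes tt) xs) (ℕ.+-identityʳ (length xs))

  consF-↑ˡ : ∀ {a} b x (β : Fin (a ℕ.+ b) → 𝔽) i → consF p x β (i ↑ˡ b) ≡ consF p x (β ∘ (_↑ˡ b)) i
  consF-↑ˡ b x β zero    = refl
  consF-↑ˡ b x β (suc i) = refl

  consF-cong : ∀ {k} x {β β′ : Fin k → 𝔽} → (∀ i → β i ≡ β′ i) → ∀ i → consF p x β i ≡ consF p x β′ i
  consF-cong x β≗β′ zero    = refl
  consF-cong x β≗β′ (suc i) = β≗β′ i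

  count-split : ∀ a b {P : (Fin a → 𝔽) → Set} {Q : (Fin b → 𝔽) → Set} (P? : Decidable P) (Q? : Decidable Q) →
                Extensional P →
                count (λ β → P? (β ∘ (_↑ˡ b)) ×-dec Q? (β ∘ (a ↑ʳ_))) (allFns p (a ℕ.+ b)) ≡
                count P? (allFns p a) ℕ.* count Q? (allFns p b)
  count-split zero b P? Q? ext = split₀ _
    where
    split₀ : ∀ e → count (λ β → P? (β ∘ (_↑ˡ b)) ×-dec Q? β) (allFns p b) ≡ count P? (e ∷ []) ℕ.* count Q? (allFns p b)
    split₀ e = begin
      count (λ β → P? (β ∘ (_↑ˡ b)) ×-dec Q? β) (allFns p b)
        ≡⟨ count-≐ (λ β → P? (β ∘ (_↑ˡ b)) ×-dec Q? β) (λ β → P? e ×-dec Q? β)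
                   ((λ (Pβ , Qβ) → ext (λ ()) Pβ , Qβ) , (λ (Pe , Qβ) → ext (λ ()) Pe , Qβ)) (allFns p b) ⟩
      count (λ β → P? e ×-dec Q? β) (allFns p b)  ≡⟨ count-×-const (P? e) Q? (allFns p b) ⟩
      indicator (P? e) ℕ.* count Q? (allFns p b)        ≡⟨ cong (ℕ._* _) (trans (count-∷ P? e []) (ℕ.+-identityʳ _)) ⟨
      count P? (e ∷ []) ℕ.* count Q? (allFns p b) ∎
      where open ≡-Reasoning
  count-split (suc a) b {P} {Q} P? Q? ext = begin
    count R? (allFns p (suc (a ℕ.+ b)))
      ≡⟨ count-allFns-suc R? ⟩
    sumˡ (map (λ x → count (R? ∘ consF p x) (allFns p (a ℕ.+ b))) (allFin p))
      ≡⟨ cong sumˡ (map-cong (λ x → trans (count-≐ (R? ∘ consF p x) (R′? x) (≐-consF x) (allFns p (a ℕ.+ b)))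
                                            (count-split a b (P? ∘ consF p x) Q? (ext ∘ consF-cong x))) (allFin p)) ⟩
    sumˡ (map (λ x → count (P? ∘ consF p x) (allFns p a) ℕ.* count Q? (allFns p b)) (allFin p))
      ≡⟨ sum-map-*ʳ (λ x → count (P? ∘ consF p x) (allFns p a)) _ (allFin p) ⟩
    sumˡ (map (λ x → count (P? ∘ consF p x) (allFns p a)) (allFin p)) ℕ.* count Q? (allFns p b)
      ≡⟨ cong (ℕ._* _) (count-allFns-suc P?) ⟨
    count P? (allFns p (suc a)) ℕ.* count Q? (allFns p b) ∎
    where
    open ≡-Reasoning
    R : (Fin (suc a ℕ.+ b) → 𝔽) → Set
    R β = P (β ∘ (_↑ˡ b)) × Q (β ∘ (suc a ↑ʳ_))
    R? : Decidable R
    R? β = P? (β ∘ (_↑ˡ b)) ×-dec Q? (β ∘ (suc a ↑ʳ_))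
    R′ : 𝔽 → (Fin (a ℕ.+ b) → 𝔽) → Set
    R′ x β = P (consF p x (β ∘ (_↑ˡ b))) × Q (β ∘ (a ↑ʳ_))
    R′? : ∀ x → Decidable (R′ x)
    R′? x β = P? (consF p x (β ∘ (_↑ˡ b))) ×-dec Q? (β ∘ (a ↑ʳ_))
    ≐-consF : ∀ x → (R ∘ consF p x) ≐ R′ x
    ≐-consF x = (λ (Pβ , Qβ) → ext (consF-↑ˡ b x _) Pβ , Qβ) , (λ (Pβ , Qβ) → ext (sym ∘ consF-↑ˡ b x _) Pβ , Qβ)

  AllRows : ∀ {m} h → ((Fin m → 𝔽) → Set) → (Fin (h ℕ.* m) → 𝔽) → Set
  AllRows h R β = ∀ (u : Fin h) → R (λ j → β (combine u j))

  allRows? : ∀ {m} h {R : (Fin m → 𝔽) → Set} → Decidable R → Decidable (AllRows h R)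
  allRows? h R? β = Fin.all? (λ (u : Fin h) → R? (λ j → β (combine u j)))

  count-allRows : ∀ {m} h {R : (Fin m → 𝔽) → Set} (R? : Decidable R) → Extensional R →
                  count (allRows? h R?) (allFns p (h ℕ.* m)) ≡ count R? (allFns p m) ^ h
  count-allRows zero    R? ext = count-≐ (allRows? zero R?) (λ _ → yes tt) ((λ _ → tt) , (λ _ ())) (allFns p 0)
  count-allRows {m} (suc h) R? ext = begin
    count (allRows? (suc h) R?) (allFns p (m ℕ.+ h ℕ.* m))
      ≡⟨ count-≐ (allRows? (suc h) R?) (λ β → R? (β ∘ (_↑ˡ (h ℕ.* m))) ×-dec allRows? h R? (β ∘ (m ↑ʳ_)))
                 ((λ rows → rows zero , rows ∘ suc) , (λ (row₀ , rows) → λ { zero → row₀ ; (suc u) → rows u }))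
                 (allFns p (m ℕ.+ h ℕ.* m)) ⟩
    count (λ β → R? (β ∘ (_↑ˡ (h ℕ.* m))) ×-dec allRows? h R? (β ∘ (m ↑ʳ_))) (allFns p (m ℕ.+ h ℕ.* m))
      ≡⟨ count-split m (h ℕ.* m) R? (allRows? h R?) ext ⟩
    count R? (allFns p m) ℕ.* count (allRows? h R?) (allFns p (h ℕ.* m))
      ≡⟨ cong (count R? (allFns p m) ℕ.*_) (count-allRows h R? ext) ⟩
    count R? (allFns p m) ℕ.* count R? (allFns p m) ^ h ∎
    where open ≡-Reasoning

  NonRoot : ∀ {m} → 𝔽 → (Fin m → 𝔽) → (Fin m → 𝔽) → Set
  NonRoot {m} c a b = c ⊕ ∑[ j < m ] (b j ⊗ a j) ≢ 𝟘

  nonRoot? : ∀ {m} c (a : Fin m → 𝔽) → Decidable (NonRoot c a)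
  nonRoot? {m} c a b = ¬? (c ⊕ ∑[ j < m ] (b j ⊗ a j) ≟ 𝟘)

  nonRoot-extensional : ∀ {m} c (a : Fin m → 𝔽) → Extensional (NonRoot c a)
  nonRoot-extensional c a b≗b′ ne eq = ne (trans (cong (c ⊕_) (sum-cong-≗ (λ j → cong (_⊗ a j) (b≗b′ j)))) eq)

  nonRoot-consF : ∀ {m} c (a : Fin (suc m) → 𝔽) x →
                  (NonRoot c a ∘ consF p x) ≐ NonRoot (c ⊕ x ⊗ a zero) (a ∘ suc)
  nonRoot-consF c a x = (λ ne eq → ne (trans (sym (⊕-assoc c _ _)) eq)) , (λ ne eq → ne (trans (⊕-assoc c _ _) eq))

  count-nonRoot : Prime p → ∀ {m} c (a : Fin m → 𝔽) i → a i ≢ 𝟘 →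
                  count (nonRoot? c a) (allFns p m) ℕ.* p ≤ (p ∸ 1) ℕ.* p ^ m
  count-nonRoot p-prime {suc m} c a i aᵢ≢𝟘 with Fin.any? (λ j → ¬? (a (suc j) ≟ 𝟘))
  ... | yes (j , aⱼ₊₁≢𝟘) = begin
    count (nonRoot? c a) (allFns p (suc m)) ℕ.* p
      ≡⟨ cong (ℕ._* p) (count-allFns-suc (nonRoot? c a)) ⟩
    sumˡ (map (λ x → count (nonRoot? c a ∘ consF p x) (allFns p m)) (allFin p)) ℕ.* p
      ≡⟨ sum-map-*ʳ (λ x → count (nonRoot? c a ∘ consF p x) (allFns p m)) p (allFin p) ⟨
    sumˡ (map (λ x → count (nonRoot? c a ∘ consF p x) (allFns p m) ℕ.* p) (allFin p))
      ≤⟨ sum-map-mono (λ x → ℕ.≤-trans (ℕ.≤-reflexive (cong (ℕ._* p) (count-≐ _ _ (nonRoot-consF c a x) (allFns p m))))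
                                        (count-nonRoot p-prime (c ⊕ x ⊗ a zero) (a ∘ suc) j aⱼ₊₁≢𝟘)) (allFin p) ⟩
    sumˡ (map (λ _ → (p ∸ 1) ℕ.* p ^ m) (allFin p))
      ≡⟨ sum-map-const _ (allFin p) ⟩
    length (allFin p) ℕ.* ((p ∸ 1) ℕ.* p ^ m)
      ≡⟨ cong (ℕ._* ((p ∸ 1) ℕ.* p ^ m)) length-allFin ⟩
    p ℕ.* ((p ∸ 1) ℕ.* p ^ m)
      ≡⟨ swap p (p ∸ 1) (p ^ m) ⟩
    (p ∸ 1) ℕ.* p ^ suc m ∎
    where
    open ℕ.≤-Reasoning
    swap : ∀ x y z → x ℕ.* (y ℕ.* z) ≡ y ℕ.* (x ℕ.* z)
    swap = solve-∀
  ... | no none = begin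
    count (nonRoot? c a) (allFns p (suc m)) ℕ.* p
      ≡⟨ cong (ℕ._* p) (count-allFns-suc (nonRoot? c a)) ⟩
    sumˡ (map (λ x → count (nonRoot? c a ∘ consF p x) (allFns p m)) (allFin p)) ℕ.* p
      ≡⟨ cong (λ s → sumˡ s ℕ.* p) (map-cong count-slice (allFin p)) ⟩
    sumˡ (map (λ x → indicator (root? x) ℕ.* p ^ m) (allFin p)) ℕ.* p
      ≡⟨ cong (ℕ._* p) (sum-map-indicator root? (p ^ m) (allFin p)) ⟩
    count root? (allFin p) ℕ.* p ^ m ℕ.* p
      ≤⟨ ℕ.*-monoˡ-≤ p (ℕ.*-monoˡ-≤ (p ^ m) count-root≤) ⟩
    (p ∸ 1) ℕ.* p ^ m ℕ.* p
      ≡⟨ swap (p ∸ 1) (p ^ m) p ⟩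
    (p ∸ 1) ℕ.* p ^ suc m ∎
    where
    open ℕ.≤-Reasoning
    swap : ∀ x y z → x ℕ.* y ℕ.* z ≡ x ℕ.* (z ℕ.* y)
    swap = solve-∀
    rest≡𝟘 : ∀ j → a (suc j) ≡ 𝟘
    rest≡𝟘 j = decidable-stable (a (suc j) ≟ 𝟘) (λ aⱼ₊₁≢𝟘 → none (j , aⱼ₊₁≢𝟘))
    a₀≢𝟘 : a zero ≢ 𝟘
    a₀≢𝟘 = head-nonzero i aᵢ≢𝟘
      where
      head-nonzero : ∀ i → a i ≢ 𝟘 → a zero ≢ 𝟘
      head-nonzero zero    a₀≢𝟘 = a₀≢𝟘
      head-nonzero (suc j) aⱼ₊₁≢𝟘 = contradiction (rest≡𝟘 j) aⱼ₊₁≢𝟘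
    root? : Decidable (λ x → c ⊕ x ⊗ a zero ≢ 𝟘)
    root? x = ¬? (c ⊕ x ⊗ a zero ≟ 𝟘)
    only-x-matters : ∀ x → (NonRoot c a ∘ consF p x) ≐ (λ _ → c ⊕ x ⊗ a zero ≢ 𝟘)
    only-x-matters x = (λ {b} ne eq → ne (trans (cong (c ⊕_) (tail-vanishes b)) eq))
                     , (λ {b} ne eq → ne (trans (cong (c ⊕_) (sym (tail-vanishes b))) eq))
      where
      tail-vanishes : ∀ b → x ⊗ a zero ⊕ ∑[ j < m ] (b j ⊗ a (suc j)) ≡ x ⊗ a zero
      tail-vanishes b = trans (cong (x ⊗ a zero ⊕_) (∑-zero _ (λ j → trans (cong (b j ⊗_) (rest≡𝟘 j)) (zeroʳ (b j)))))
                              (+-identityʳ _)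
    count-slice : ∀ x → count (nonRoot? c a ∘ consF p x) (allFns p m) ≡ indicator (root? x) ℕ.* p ^ m
    count-slice x = begin-equality
      count (nonRoot? c a ∘ consF p x) (allFns p m)
        ≡⟨ count-≐ (nonRoot? c a ∘ consF p x) (λ _ → root? x) (only-x-matters x) (allFns p m) ⟩
      count (λ _ → root? x) (allFns p m)  ≡⟨ count-const (root? x) (allFns p m) ⟩
      indicator (root? x) ℕ.* length (allFns p m) ≡⟨ cong (indicator (root? x) ℕ.*_) (length-allFns m) ⟩
      indicator (root? x) ℕ.* p ^ m ∎
    count-root≤ : count root? (allFin p) ≤ p ∸ 1
    count-root≤ with x₀ , x₀-root ← affine-root p-prime c a₀≢𝟘 =
      ℕ.≤-pred (subst (count root? (allFin p) <_) (trans length-allFin (sym (ℕ.suc-pred p)))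
                      (filter-notAll root? (allFin p) (lose (∈-allFin x₀) (λ ne → ne x₀-root))))


rising : ℕ → ℕ → ℕ
rising h zero    = 1
rising h (suc t) = rising h t ℕ.* (h ℕ.+ t)

^≤rising : ∀ h t → h ^ t ≤ rising h t
^≤rising h zero    = ℕ.≤-refl
^≤rising h (suc t) = subst (_≤ rising h t ℕ.* (h ℕ.+ t)) (ℕ.*-comm (h ^ t) h)
                           (ℕ.*-mono-≤ (^≤rising h t) (ℕ.m≤m+n h t))

rising-suc : ∀ h t → rising h (suc t) ≡ h ℕ.* rising (suc h) t
rising-suc h zero    = trans (ℕ.*-identityˡ (h ℕ.+ 0)) (trans (ℕ.+-identityʳ h) (sym (ℕ.*-identityʳ h)))
rising-suc h (suc t) = begin
  rising h (suc t) ℕ.* (h ℕ.+ suc t)          ≡⟨ cong₂ ℕ._*_ (rising-suc h t) (ℕ.+-suc h t) ⟩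
  h ℕ.* rising (suc h) t ℕ.* (suc h ℕ.+ t)    ≡⟨ ℕ.*-assoc h _ _ ⟩
  h ℕ.* (rising (suc h) t ℕ.* (suc h ℕ.+ t))  ∎
  where open ≡-Reasoning

rising-pascal : ∀ h N → rising (suc h) (suc N) ≡ suc N ℕ.* rising (suc h) N ℕ.+ rising h (suc N)
rising-pascal h N = begin
  rising (suc h) N ℕ.* (suc h ℕ.+ N)                                ≡⟨ expand (rising (suc h) N) h N ⟩
  suc N ℕ.* rising (suc h) N ℕ.+ h ℕ.* rising (suc h) N             ≡⟨ cong (suc N ℕ.* rising (suc h) N ℕ.+_) (rising-suc h N) ⟨
  suc N ℕ.* rising (suc h) N ℕ.+ rising h (suc N)                   ∎
  where
  open ≡-Reasoning
  expand : ∀ r h N → r ℕ.* (suc h ℕ.+ N) ≡ suc N ℕ.* r ℕ.+ h ℕ.* r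
  expand = solve-∀

rising-0 : ∀ t → rising 0 (suc t) ≡ 0
rising-0 zero    = refl
rising-0 (suc t) = cong (ℕ._* suc t) (rising-0 t)


↧ₙ[n/d]≡d : ∀ n d .{{_ : NonZero d}} → ↧ₙ (n Q./ d) ≡ d
↧ₙ[n/d]≡d n (suc d) = refl

↧≡+↧ₙ : ∀ x → ↧ x ≡ + ↧ₙ x
↧≡+↧ₙ (mkℚᵘ _ _) = refl

↥-* : ∀ x y → ↥ (x Q.* y) ≡ ↥ x ℤ.* ↥ y
↥-* (mkℚᵘ _ _) (mkℚᵘ _ _) = refl

↧-* : ∀ x y → ↧ₙ (x Q.* y) ≡ ↧ₙ x ℕ.* ↧ₙ y
↧-* (mkℚᵘ _ _) (mkℚᵘ _ _) = refl

↥-+ : ∀ x y → ↥ (x Q.+ y) ≡ ↥ x ℤ.* ↧ y ℤ.+ ↥ y ℤ.* ↧ x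
↥-+ (mkℚᵘ _ _) (mkℚᵘ _ _) = refl

↧-+ : ∀ x y → ↧ₙ (x Q.+ y) ≡ ↧ₙ x ℕ.* ↧ₙ y
↧-+ (mkℚᵘ _ _) (mkℚᵘ _ _) = refl

module ExponentialBound (q : ℕ) where

  p : ℕ
  p = suc q

  -- series h N = N! p^N Σ_{t ≤ N} rising h t / (t! p^t), the partial sum A_h of (1 - 1/p)^(-h)
  -- with its denominators cleared.
  series : ℕ → ℕ → ℕ
  series h zero    = 1
  series h (suc N) = suc N ℕ.* p ℕ.* series h N ℕ.+ rising h (suc N)

  series-step : ∀ h N → q ℕ.* series (suc h) N ℕ.+ rising (suc h) N ≡ p ℕ.* series h N
  series-step h zero    = base q
    where
    base : ∀ q → q ℕ.* 1 ℕ.+ 1 ≡ suc q ℕ.* 1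
    base = solve-∀
  series-step h (suc N) = begin
    q ℕ.* (suc N ℕ.* p ℕ.* series (suc h) N ℕ.+ rising (suc h) (suc N)) ℕ.+ rising (suc h) (suc N)
      ≡⟨ regroup₁ q (suc N) (series (suc h) N) (rising (suc h) (suc N)) ⟩
    suc N ℕ.* p ℕ.* (q ℕ.* series (suc h) N) ℕ.+ p ℕ.* rising (suc h) (suc N)
      ≡⟨ cong (λ r → suc N ℕ.* p ℕ.* (q ℕ.* series (suc h) N) ℕ.+ p ℕ.* r) (rising-pascal h N) ⟩
    suc N ℕ.* p ℕ.* (q ℕ.* series (suc h) N) ℕ.+ p ℕ.* (suc N ℕ.* rising (suc h) N ℕ.+ rising h (suc N))
      ≡⟨ regroup₂ (suc N) p (q ℕ.* series (suc h) N) (rising (suc h) N) (rising h (suc N)) ⟩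
    suc N ℕ.* p ℕ.* (q ℕ.* series (suc h) N ℕ.+ rising (suc h) N) ℕ.+ p ℕ.* rising h (suc N)
      ≡⟨ cong (λ s → suc N ℕ.* p ℕ.* s ℕ.+ p ℕ.* rising h (suc N)) (series-step h N) ⟩
    suc N ℕ.* p ℕ.* (p ℕ.* series h N) ℕ.+ p ℕ.* rising h (suc N)
      ≡⟨ regroup₃ (suc N) p (series h N) (rising h (suc N)) ⟩
    p ℕ.* (suc N ℕ.* p ℕ.* series h N ℕ.+ rising h (suc N)) ∎
    where
    open ≡-Reasoning
    regroup₁ : ∀ q n g r → q ℕ.* (n ℕ.* suc q ℕ.* g ℕ.+ r) ℕ.+ r ≡ n ℕ.* suc q ℕ.* (q ℕ.* g) ℕ.+ suc q ℕ.* r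
    regroup₁ = solve-∀
    regroup₂ : ∀ n p a r s → n ℕ.* p ℕ.* a ℕ.+ p ℕ.* (n ℕ.* r ℕ.+ s) ≡ n ℕ.* p ℕ.* (a ℕ.+ r) ℕ.+ p ℕ.* s
    regroup₂ = solve-∀
    regroup₃ : ∀ n p g r → n ℕ.* p ℕ.* (p ℕ.* g) ℕ.+ p ℕ.* r ≡ p ℕ.* (n ℕ.* p ℕ.* g ℕ.+ r)
    regroup₃ = solve-∀

  series-0 : ∀ N → series 0 N ≡ N ! ℕ.* p ^ N
  series-0 zero    = refl
  series-0 (suc N) = begin
    suc N ℕ.* p ℕ.* series 0 N ℕ.+ rising 0 (suc N)  ≡⟨ cong₂ (λ s r → suc N ℕ.* p ℕ.* s ℕ.+ r) (series-0 N) (rising-0 N) ⟩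
    suc N ℕ.* p ℕ.* (N ! ℕ.* p ^ N) ℕ.+ 0            ≡⟨ regroup (suc N) p (N !) (p ^ N) ⟩
    suc N ℕ.* N ! ℕ.* (p ℕ.* p ^ N)                  ∎
    where
    open ≡-Reasoning
    regroup : ∀ n p f e → n ℕ.* p ℕ.* (f ℕ.* e) ℕ.+ 0 ≡ n ℕ.* f ℕ.* (p ℕ.* e)
    regroup = solve-∀

  series-bound : ∀ h N → q ^ h ℕ.* series h N ≤ p ^ h ℕ.* (N ! ℕ.* p ^ N)
  series-bound zero    N = ℕ.≤-reflexive (trans (ℕ.*-identityˡ _) (trans (series-0 N) (sym (ℕ.*-identityˡ _))))
  series-bound (suc h) N = begin
    q ℕ.* q ^ h ℕ.* series (suc h) N                   ≡⟨ ℕ.*-assoc q (q ^ h) _ ⟩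
    q ℕ.* (q ^ h ℕ.* series (suc h) N)                 ≡⟨ swap q (q ^ h) _ ⟩
    q ^ h ℕ.* (q ℕ.* series (suc h) N)                 ≤⟨ ℕ.*-monoʳ-≤ (q ^ h) (ℕ.m≤m+n _ (rising (suc h) N)) ⟩
    q ^ h ℕ.* (q ℕ.* series (suc h) N ℕ.+ rising (suc h) N) ≡⟨ cong (q ^ h ℕ.*_) (series-step h N) ⟩
    q ^ h ℕ.* (p ℕ.* series h N)                       ≡⟨ swap (q ^ h) p _ ⟩
    p ℕ.* (q ^ h ℕ.* series h N)                       ≤⟨ ℕ.*-monoʳ-≤ p (series-bound h N) ⟩
    p ℕ.* (p ^ h ℕ.* (N ! ℕ.* p ^ N))                  ≡⟨ ℕ.*-assoc p (p ^ h) _ ⟨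
    p ℕ.* p ^ h ℕ.* (N ! ℕ.* p ^ N)                    ∎
    where
    open ℕ.≤-Reasoning
    swap : ∀ x y z → x ℕ.* (y ℕ.* z) ≡ y ℕ.* (x ℕ.* z)
    swap = solve-∀


  module _ (h : ℕ) where

    termDen : ℕ → ℕ
    termDen t = p ^ t ℕ.* t !

    -- The numerator and denominator that (unnormalised) ℚᵘ arithmetic computes for expPartial h p N.
    partialNum partialDen : ℕ → ℕ
    partialNum zero    = 1
    partialNum (suc N) = partialNum N ℕ.* termDen (suc N) ℕ.+ h ^ suc N ℕ.* partialDen N
    partialDen zero    = 1
    partialDen (suc N) = partialDen N ℕ.* termDen (suc N)

    ↥-expTerm : ∀ t → ↥ expTerm h p t ≡ + h ^ t
    ↥-expTerm t = trans (↥-* (Q._/_ (+ h ^ t) (p ^ t) {{ℕ.m^n≢0 p t}}) (Q._/_ (+ 1) (t !) {{t ℕ.!≢0}}))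
                        (trans (cong₂ ℤ._*_ (↥[n/d]≡n (+ h ^ t) (p ^ t) {{ℕ.m^n≢0 p t}}) (↥[n/d]≡n (+ 1) (t !) {{t ℕ.!≢0}}))
                               (ℤ.*-identityʳ _))

    ↧-expTerm : ∀ t → ↧ₙ expTerm h p t ≡ termDen t
    ↧-expTerm t = trans (↧-* (Q._/_ (+ h ^ t) (p ^ t) {{ℕ.m^n≢0 p t}}) (Q._/_ (+ 1) (t !) {{t ℕ.!≢0}}))
                        (cong₂ ℕ._*_ (↧ₙ[n/d]≡d (+ h ^ t) (p ^ t) {{ℕ.m^n≢0 p t}}) (↧ₙ[n/d]≡d (+ 1) (t !) {{t ℕ.!≢0}}))

    ↥-expPartial : ∀ N → ↥ expPartial h p N ≡ + partialNum N
    ↧-expPartial : ∀ N → ↧ₙ expPartial h p N ≡ partialDen N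
    ↥-expPartial zero    = ↥-expTerm 0
    ↥-expPartial (suc N) = begin
      ↥ (S Q.+ T)                         ≡⟨ ↥-+ S T ⟩
      ↥ S ℤ.* ↧ T ℤ.+ ↥ T ℤ.* ↧ S
        ≡⟨ cong₂ ℤ._+_ (cong₂ ℤ._*_ (↥-expPartial N) (trans (↧≡+↧ₙ T) (cong +_ (↧-expTerm (suc N)))))
                       (cong₂ ℤ._*_ (↥-expTerm (suc N)) (trans (↧≡+↧ₙ S) (cong +_ (↧-expPartial N)))) ⟩
      + partialNum N ℤ.* + termDen (suc N) ℤ.+ + h ^ suc N ℤ.* + partialDen N
        ≡⟨ cong₂ ℤ._+_ (ℤ.pos-* (partialNum N) _) (ℤ.pos-* (h ^ suc N) _) ⟨
      + (partialNum N ℕ.* termDen (suc N)) ℤ.+ + (h ^ suc N ℕ.* partialDen N)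
        ≡⟨ ℤ.pos-+ (partialNum N ℕ.* termDen (suc N)) (h ^ suc N ℕ.* partialDen N) ⟨
      + partialNum (suc N)                ∎
      where
      open ≡-Reasoning
      S = expPartial h p N
      T = expTerm h p (suc N)
    ↧-expPartial zero    = ↧-expTerm 0
    ↧-expPartial (suc N) = trans (↧-+ (expPartial h p N) (expTerm h p (suc N))) (cong₂ ℕ._*_ (↧-expPartial N) (↧-expTerm (suc N)))

    partial≤series : ∀ N → partialNum N ℕ.* (N ! ℕ.* p ^ N) ≤ partialDen N ℕ.* series h N
    partial≤series zero    = ℕ.≤-refl
    partial≤series (suc N) = begin
      (s ℕ.* d ℕ.+ h ^ suc N ℕ.* e) ℕ.* (suc N ℕ.* N ! ℕ.* (p ℕ.* p ^ N))
        ≡⟨ regroup₁ s (h ^ suc N) e (suc N) (N !) p (p ^ N) ⟩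
      d ℕ.* suc N ℕ.* p ℕ.* (s ℕ.* (N ! ℕ.* p ^ N)) ℕ.+ h ^ suc N ℕ.* e ℕ.* d
        ≤⟨ ℕ.+-mono-≤ (ℕ.*-monoʳ-≤ (d ℕ.* suc N ℕ.* p) (partial≤series N))
                      (ℕ.*-monoˡ-≤ d (ℕ.*-monoˡ-≤ e (^≤rising h (suc N)))) ⟩
      d ℕ.* suc N ℕ.* p ℕ.* (e ℕ.* series h N) ℕ.+ rising h (suc N) ℕ.* e ℕ.* d
        ≡⟨ regroup₂ d (suc N) p e (series h N) (rising h (suc N)) ⟩
      e ℕ.* d ℕ.* (suc N ℕ.* p ℕ.* series h N ℕ.+ rising h (suc N)) ∎
      where
      open ℕ.≤-Reasoning
      s = partialNum N
      e = partialDen N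
      d = termDen (suc N)
      regroup₁ : ∀ s n e N f p x → (s ℕ.* (p ℕ.* x ℕ.* (N ℕ.* f)) ℕ.+ n ℕ.* e) ℕ.* (N ℕ.* f ℕ.* (p ℕ.* x)) ≡
                                   p ℕ.* x ℕ.* (N ℕ.* f) ℕ.* N ℕ.* p ℕ.* (s ℕ.* (f ℕ.* x)) ℕ.+ n ℕ.* e ℕ.* (p ℕ.* x ℕ.* (N ℕ.* f))
      regroup₁ = solve-∀
      regroup₂ : ∀ d N p e g r → d ℕ.* N ℕ.* p ℕ.* (e ℕ.* g) ℕ.+ r ℕ.* e ℕ.* d ≡ e ℕ.* d ℕ.* (N ℕ.* p ℕ.* g ℕ.+ r)
      regroup₂ = solve-∀

    partialSum-bound : ∀ N → partialNum N ℕ.* q ^ h ≤ partialDen N ℕ.* p ^ h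
    partialSum-bound N = ℕ.*-cancelʳ-≤ _ _ X {{ℕ.m*n≢0 (N !) (p ^ N) {{N ℕ.!≢0}} {{ℕ.m^n≢0 p N}}}} (begin
      partialNum N ℕ.* q ^ h ℕ.* X          ≡⟨ swap (partialNum N) (q ^ h) X ⟩
      q ^ h ℕ.* (partialNum N ℕ.* X)        ≤⟨ ℕ.*-monoʳ-≤ (q ^ h) (partial≤series N) ⟩
      q ^ h ℕ.* (partialDen N ℕ.* series h N) ≡⟨ ℕ.*-assoc (q ^ h) _ _ ⟨
      q ^ h ℕ.* partialDen N ℕ.* series h N ≡⟨ cong (ℕ._* series h N) (ℕ.*-comm (q ^ h) (partialDen N)) ⟩
      partialDen N ℕ.* q ^ h ℕ.* series h N ≡⟨ ℕ.*-assoc (partialDen N) _ _ ⟩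
      partialDen N ℕ.* (q ^ h ℕ.* series h N) ≤⟨ ℕ.*-monoʳ-≤ (partialDen N) (series-bound h N) ⟩
      partialDen N ℕ.* (p ^ h ℕ.* X)        ≡⟨ ℕ.*-assoc (partialDen N) (p ^ h) X ⟨
      partialDen N ℕ.* p ^ h ℕ.* X          ∎)
      where
      open ℕ.≤-Reasoning
      X = N ! ℕ.* p ^ N
      swap : ∀ x y z → x ℕ.* y ℕ.* z ≡ y ℕ.* (x ℕ.* z)
      swap = solve-∀

    fraction-LeExpNeg : ∀ k cnt → cnt ℕ.* p ^ h ≤ q ^ h ℕ.* p ^ k →
                        LeExpNeg (Q._/_ (+ cnt) (p ^ k) {{ℕ.m^n≢0 p k}}) h p
    fraction-LeExpNeg k cnt cnt-bound N = *≤* (subst₂ ℤ._≤_ (sym ↥-side) (sym ↧-side) (ℤ.+≤+ cross-bound))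
      where
      x = Q._/_ (+ cnt) (p ^ k) {{ℕ.m^n≢0 p k}}
      S = expPartial h p N
      ↥-side : ↥ (x Q.* S) ℤ.* ↧ Q.1ℚᵘ ≡ + (cnt ℕ.* partialNum N)
      ↥-side = trans (ℤ.*-identityʳ _) (trans (↥-* x S)
                 (trans (cong₂ ℤ._*_ (↥[n/d]≡n (+ cnt) (p ^ k) {{ℕ.m^n≢0 p k}}) (↥-expPartial N)) (sym (ℤ.pos-* cnt _))))
      ↧-side : ↥ Q.1ℚᵘ ℤ.* ↧ (x Q.* S) ≡ + (p ^ k ℕ.* partialDen N)
      ↧-side = trans (ℤ.*-identityˡ _) (trans (↧≡+↧ₙ (x Q.* S))
                 (cong +_ (trans (↧-* x S) (cong₂ ℕ._*_ (↧ₙ[n/d]≡d (+ cnt) (p ^ k) {{ℕ.m^n≢0 p k}}) (↧-expPartial N)))))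
      cross-bound : cnt ℕ.* partialNum N ≤ p ^ k ℕ.* partialDen N
      cross-bound = ℕ.*-cancelʳ-≤ _ _ (p ^ h) {{ℕ.m^n≢0 p h}} (begin
        cnt ℕ.* partialNum N ℕ.* p ^ h          ≡⟨ swap₁ cnt (partialNum N) (p ^ h) ⟩
        cnt ℕ.* p ^ h ℕ.* partialNum N          ≤⟨ ℕ.*-monoˡ-≤ (partialNum N) cnt-bound ⟩
        q ^ h ℕ.* p ^ k ℕ.* partialNum N        ≡⟨ swap₂ (q ^ h) (p ^ k) (partialNum N) ⟩
        p ^ k ℕ.* (partialNum N ℕ.* q ^ h)      ≤⟨ ℕ.*-monoʳ-≤ (p ^ k) (partialSum-bound N) ⟩
        p ^ k ℕ.* (partialDen N ℕ.* p ^ h)      ≡⟨ ℕ.*-assoc (p ^ k) _ _ ⟨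
        p ^ k ℕ.* partialDen N ℕ.* p ^ h        ∎)
        where
        open ℕ.≤-Reasoning
        swap₁ : ∀ a b c → a ℕ.* b ℕ.* c ≡ a ℕ.* c ℕ.* b
        swap₁ = solve-∀
        swap₂ : ∀ a b c → a ℕ.* b ℕ.* c ≡ b ℕ.* (c ℕ.* a)
        swap₂ = solve-∀


module GoodSubstitutions (p : ℕ) .{{_ : NonZero p}} (p-prime : Prime p) {n m d : ℕ} (h : ℕ) (g : Fin m → Poly p n)
                         {ω : Poly p n → Fp p} (lin : IsLinearOn p n d ω)
                         (degE : ∀ i → DegLe p (Companion.N p n m h g) d (Companion.E p n m h g i)) (i : Fin m) where

  open PrimeField p
  open Coefficients p
  open Substitution p
  open Degree p
  open Counting p
  open Companion p n m h g
  open CompanionPolynomials p p-prime h g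
  open LinearFunctional p lin

  Good : (Fin (h ℕ.* m) → 𝔽) → Set
  Good β = All (λ f → ω (substP p (h ℕ.* m) β f) ≢ 𝟘) (factors i)

  GoodRow : (Fin m → 𝔽) → Set
  GoodRow = NonRoot (ω (oneP p n)) (λ j → ⊖ 𝟙 ⊗ ω (g j))

  goodRow? : Decidable GoodRow
  goodRow? = nonRoot? (ω (oneP p n)) (λ j → ⊖ 𝟙 ⊗ ω (g j))

  module _ (ωgᵢ≢𝟘 : ω (g i) ≢ 𝟘) where

    gᵢ-nonvanishing : Nonvanishing n (g i)
    gᵢ-nonvanishing with vanishes⊎nonvanishing n (g i)
    ... | inj₂ nz    = nz
    ... | inj₁ gᵢ≡𝟘 = contradiction (trans (ω-resp (λ α _ → gᵢ≡𝟘 α) (λ α _ → zeroP-vanishes n α)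
                                                    (λ α → trans (gᵢ≡𝟘 α) (sym (zeroP-vanishes n α)))) ω-zeroP) ωgᵢ≢𝟘

    good⇒goodRows : ∀ {β} → Good β → AllRows h GoodRow β
    good⇒goodRows {β} (_ ∷ good-linFactors) u =
      subst (_≢ 𝟘) (ω-substP-linFactor lin (DegLe-E⇒DegLe-g i (degE i) gᵢ-nonvanishing u) β u)
            (All.lookup good-linFactors (∈-map⁺ linFactor (∈-allFin u)))

  count-good : (good? : Decidable Good) → count good? (allFns p (h ℕ.* m)) ℕ.* p ^ h ≤ (p ∸ 1) ^ h ℕ.* p ^ (h ℕ.* m)
  count-good good? with ω (g i) ≟ 𝟘
  ... | yes ωgᵢ≡𝟘 = ℕ.≤-trans (ℕ.≤-reflexive (cong (ℕ._* p ^ h) no-good)) z≤n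
    where
    no-good : count good? (allFns p (h ℕ.* m)) ≡ 0
    no-good = cong length (filter-none good? {allFns p (h ℕ.* m)} (All.universal (λ β good →
                All.head good (trans (cong ω (substP-embP (h ℕ.* m) β (g i))) ωgᵢ≡𝟘)) _))
  ... | no ωgᵢ≢𝟘 = begin
    count good? (allFns p (h ℕ.* m)) ℕ.* p ^ h
      ≤⟨ ℕ.*-monoˡ-≤ (p ^ h) (count-mono good? (allRows? h goodRow?) (good⇒goodRows ωgᵢ≢𝟘) (allFns p (h ℕ.* m))) ⟩
    count (allRows? h goodRow?) (allFns p (h ℕ.* m)) ℕ.* p ^ h
      ≡⟨ cong (ℕ._* p ^ h) (count-allRows h goodRow? (nonRoot-extensional _ _)) ⟩
    count goodRow? (allFns p m) ^ h ℕ.* p ^ h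
      ≡⟨ *-^ (count goodRow? (allFns p m)) p h ⟨
    (count goodRow? (allFns p m) ℕ.* p) ^ h
      ≤⟨ ℕ.^-monoˡ-≤ h (count-nonRoot p-prime _ _ i (⊗-nonzero p-prime (⊖𝟙≢𝟘 p-prime) ωgᵢ≢𝟘)) ⟩
    ((p ∸ 1) ℕ.* p ^ m) ^ h
      ≡⟨ *-^ (p ∸ 1) (p ^ m) h ⟩
    (p ∸ 1) ^ h ℕ.* (p ^ m) ^ h
      ≡⟨ cong ((p ∸ 1) ^ h ℕ.*_) (trans (ℕ.^-*-assoc p m h) (cong (p ^_) (ℕ.*-comm m h))) ⟩
    (p ∸ 1) ^ h ℕ.* p ^ (h ℕ.* m) ∎
    where open ℕ.≤-Reasoning

lemma3p3 : (p : ℕ) .{{_ : NonZero p}} → Prime p →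
    (d n : ℕ) →
    (Ω : List (Poly p n → Fp p)) → Ω ≢ [] →
    All (IsLinearOn p n d) Ω →
    (m : ℕ) (g : Fin m → Poly p n) (h : ℕ) → 1 ≤ h →
    (∀ i → DegLe p (Companion.N p n m h g) d (Companion.E p n m h g i)) →
    ∀ ω → ω ∈ Ω → ∀ (i : Fin m) →
    LeExpNeg (probAllNonzero p n m h g ω i) h p
lemma3p3 (suc q) p-prime d n Ω _ linear m g h _ degE ω ω∈Ω i =
  -- The last _ is the decision procedure
  -- for Good used inside probAllNonzero.
  ExponentialBound.fraction-LeExpNeg q h (h ℕ.* m) _
    (GoodSubstitutions.count-good (suc q) p-prime h g (All.lookup linear ω∈Ω) degE i _)
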